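{- Let $n \geq 5$ and let $T$ be a standard Young tableau of shape $(n,n)$ chosen uniformly at random. Then $$\Pr(T_{1,5} > T_{2,2}) - \Pr(T_{2,2} > T_{1,5}) \;=\; \frac{45n^2 - 135n + 30}{2(2n-5)(2n-1)(2n-3)} \;=\; \frac{45}{16}\cdot\frac{1}{n} + \frac{135}{32}\cdot\frac{1}{n^2} + \frac{75}{16}\cdot\frac{1}{n^3} + O\!\left(\frac{1}{n^4}\right).$$ Consequently, the minimal sorting probability of the shape $(n,n)$, namely $\min |SP((n,n),c_1,c_2)|$ over all pairs of distinct cells $c_1,c_2$, is $O(1/n)$ as $n\to\infty$.
   Context: A standard Young tableau of shape $(n,n)$ is a filling $T_{i,j}$ ($i\in\{1,2\}$, $1\le j\le n$) of the $2\times n$ array of cells with the integers $1,\dots,2n$, each used exactly once, such that rows increase left to right and columns increase top to bottom; $[i,j]$ denotes the cell in row $i$, column $j$. For a shape $\lambda$ and cells $c_1,c_2$, the sorting probability is $SP(\lambda,c_1,c_2) = \Pr(T_{c_1} > T_{c_2}) - \Pr(T_{c_2} > T_{c_1})$, where $T$ is a uniformly random standard Young tableau of shape $\lambda$. -}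

module Defs where

open import Data.Nat as ℕ using (ℕ; zero; suc)
import Data.Nat.Properties as ℕP
open import Data.Integer as ℤ using (ℤ)
open import Data.Fin as Fin using (Fin; toℕ)
import Data.Fin.Properties as FinP
open import Data.Product using (_×_; _,_; ∃; Σ)
import Data.Product.Properties as ProdP
open import Data.Vec as Vec using (Vec; lookup)
open import Data.List as List using (List; []; _∷_; filter; length; map; concatMap; allFin; upTo)
open import Data.Rational as ℚ using (ℚ; 0ℚ; _-_; _÷_; _⊓_; ∣_∣)
import Data.Rational.Properties as ℚP
open import Relation.Nullary using (Dec; yes; no; ¬_)
open import Relation.Nullary.Decidable using (_×-dec_; _→-dec_; ¬?)
open import Relation.Binary.PropositionalEquality using (_≡_)

-- Guarded division on ℚ (junk value 0 when the divisor is 0).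

_÷?_ : ℚ → ℚ → ℚ
p ÷? q with q ℚP.≟ 0ℚ
... | yes _ = 0ℚ
... | no q≢0 = _÷_ p q {{ℚ.≢-nonZero q≢0}}

infixl 7 _÷?_

ℕ→ℚ : ℕ → ℚ
ℕ→ℚ k = ℤ.+ k ℚ./ 1

-- Fillings of the 2 × n array.  Row i ∈ Fin 2 (zero = row 1, suc zero =
-- row 2), column j ∈ Fin n (zero = column 1).  Entries are naturals.

Filling : ℕ → Set
Filling n = Vec (Vec ℕ n) 2

Cell : ℕ → Set
Cell n = Fin 2 × Fin n

entry : ∀ {n} → Filling n → Cell n → ℕ
entry T (i , j) = lookup (lookup T i) j

record IsSYT {n : ℕ} (T : Filling n) : Set where
  field
    inRange   : ∀ i j → 1 ℕ.≤ entry T (i , j) × entry T (i , j) ℕ.≤ 2 ℕ.* n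
    injective : ∀ i j i' j' → entry T (i , j) ≡ entry T (i' , j') → (i , j) ≡ (i' , j')
    surjective : ∀ (v : Fin (2 ℕ.* n)) → ∃ λ i → ∃ λ j → entry T (i , j) ≡ suc (toℕ v)
    rowsInc   : ∀ i j j' → j Fin.< j' → entry T (i , j) ℕ.< entry T (i , j')
    colsInc   : ∀ i i' j → i Fin.< i' → entry T (i , j) ℕ.< entry T (i' , j)

isSYT? : ∀ {n} (T : Filling n) → Dec (IsSYT T)
isSYT? {n} T with all1? | all2? | all3? | all4? | all5?
  where
  all1? = FinP.all? λ i → FinP.all? λ j → (1 ℕP.≤? entry T (i , j)) ×-dec (entry T (i , j) ℕP.≤? 2 ℕ.* n)
  all2? = FinP.all? λ i → FinP.all? λ j → FinP.all? λ i' → FinP.all? λ j' →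
            (entry T (i , j) ℕP.≟ entry T (i' , j')) →-dec ProdP.≡-dec FinP._≟_ FinP._≟_ (i , j) (i' , j')
  all3? = FinP.all? λ v → FinP.any? λ i → FinP.any? λ j → entry T (i , j) ℕP.≟ suc (toℕ v)
  all4? = FinP.all? λ i → FinP.all? λ j → FinP.all? λ j' → (j Fin.<? j') →-dec (entry T (i , j) ℕP.<? entry T (i , j'))
  all5? = FinP.all? λ i → FinP.all? λ i' → FinP.all? λ j → (i Fin.<? i') →-dec (entry T (i , j) ℕP.<? entry T (i' , j))
... | yes a | yes b | yes c | yes d | yes e = yes record { inRange = a ; injective = b ; surjective = c ; rowsInc = d ; colsInc = e }
... | no ¬a | _ | _ | _ | _ = no λ t → ¬a (IsSYT.inRange t)
... | yes _ | no ¬b | _ | _ | _ = no λ t → ¬b (IsSYT.injective t)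
... | yes _ | yes _ | no ¬c | _ | _ = no λ t → ¬c (IsSYT.surjective t)
... | yes _ | yes _ | yes _ | no ¬d | _ = no λ t → ¬d (IsSYT.rowsInc t)
... | yes _ | yes _ | yes _ | yes _ | no ¬e = no λ t → ¬e (IsSYT.colsInc t)

allVecs : ∀ {A : Set} → List A → (k : ℕ) → List (Vec A k)
allVecs xs zero = Vec.[] ∷ []
allVecs xs (suc k) = concatMap (λ x → map (x Vec.∷_) (allVecs xs k)) xs

values : ℕ → List ℕ
values n = map suc (upTo (2 ℕ.* n))

allFillings : (n : ℕ) → List (Filling n)
allFillings n = allVecs (allVecs (values n) n) 2

SYT : (n : ℕ) → List (Filling n)
SYT n = filter isSYT? (allFillings n)

countGreater : (n : ℕ) → Cell n → Cell n → ℕ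
countGreater n c₁ c₂ = length (filter (λ T → entry T c₂ ℕP.<? entry T c₁) (SYT n))

Pr> : (n : ℕ) → Cell n → Cell n → ℚ
Pr> n c₁ c₂ = ℕ→ℚ (countGreater n c₁ c₂) ÷? ℕ→ℚ (length (SYT n))

SP : (n : ℕ) → Cell n → Cell n → ℚ
SP n c₁ c₂ = Pr> n c₁ c₂ - Pr> n c₂ c₁

-- Minimal sorting probability: min |SP((n,n),c₁,c₂)| over distinct cells
-- (junk value 0 if there is no pair of distinct cells, i.e. n = 0).

allCells : (n : ℕ) → List (Cell n)
allCells n = concatMap (λ i → map (i ,_) (allFin n)) (allFin 2)

distinctPairs : (n : ℕ) → List (Cell n × Cell n)
distinctPairs n =
  filter (λ p → ¬? (ProdP.≡-dec FinP._≟_ FinP._≟_ (Data.Product.proj₁ p) (Data.Product.proj₂ p)))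
         (concatMap (λ c → map (c ,_) (allCells n)) (allCells n))
  where import Data.Product

minimumℚ : List ℚ → ℚ
minimumℚ [] = 0ℚ
minimumℚ (x ∷ xs) = List.foldr _⊓_ x xs

minSP : ℕ → ℚ
minSP n = minimumℚ (map (λ p → ∣ SP n (Data.Product.proj₁ p) (Data.Product.proj₂ p) ∣) (distinctPairs n))
  where import Data.Product

cell15 : ∀ {n} → 5 ℕ.≤ n → Cell n
cell15 h = Fin.zero , Fin.fromℕ< {4} h

cell22 : ∀ {n} → 5 ℕ.≤ n → Cell n
cell22 h = Fin.suc Fin.zero , Fin.fromℕ< {1} (ℕP.≤-trans (ℕ.s≤s (ℕ.s≤s ℕ.z≤n)) h)

{-# OPTIONS --safe #-}
module Submission where

-- Recording the row of each entry 1, 2, …, 2n of a standard Young tableau of shape (n,n) is a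
-- bijection onto the ballot words of length 2n, so there are C(n) tableaux (Catalan numbers) and
-- T[2,2] < T[1,5] says that the second letter of the second row precedes the fifth letter of the
-- first. Splitting ballot words by their first letters, this happens for 9 C(n-2) - 4 C(n-3)
-- tableaux; the ratio C(p+1)(p+2) = 2(2p+1) C(p), a consequence of the reflection principle,
-- turns SP = 2 #{T[2,2] < T[1,5]} / C(n) - 1 into the stated rational function of n. Its
-- difference from the three-term expansion is (1080n² - 9750n + 4500) / (32n³ 2(2n-5)(2n-1)(2n-3)),
-- at most 4/n⁴ for n ≥ 10, and SP ≤ 4/n bounds the minimal sorting probability.

open import Data.Bool using (if_then_else_)
open import Data.Empty using (⊥)
open import Data.Fin as Fin using (Fin; zero; suc; toℕ; fromℕ<)
import Data.Fin.Properties as FinP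
open import Data.List as List using (List; []; _∷_; _++_; map; filter; length; applyUpTo; allFin)
import Data.List.Properties as LP
open import Data.List.Membership.Propositional using (_∈_)
open import Data.List.Membership.Propositional.Properties
  using (∈-map⁺; ∈-map⁻; ∈-++⁺ˡ; ∈-++⁺ʳ; ∈-++⁻; ∈-filter⁺; ∈-filter⁻; ∈-upTo⁺; ∈-allFin; ∈-cartesianProductWith⁺)
open import Data.List.Relation.Unary.Any using (here; there)
open import Data.List.Relation.Unary.All as All using (All; []; _∷_)
import Data.List.Relation.Unary.All.Properties as AllP
open import Data.List.Relation.Unary.AllPairs using ([]; _∷_)
open import Data.List.Relation.Unary.Unique.Propositional using (Unique)
import Data.List.Relation.Unary.Unique.Propositional.Properties as UniqueP
open import Data.List.Relation.Binary.Permutation.Propositional using (_↭_)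
open import Data.List.Relation.Binary.Permutation.Propositional.Properties using (↭-length; filter-↭)
open import Data.Nat as ℕ using (ℕ; zero; suc; z≤n; s≤s; NonZero)
import Data.Nat.Properties as ℕP
open import Data.Product using (_×_; _,_; ∃; ∃₂; proj₁; proj₂; map₁; uncurry)
open import Data.Sum using (_⊎_; inj₁; inj₂)
open import Data.Vec as Vec using (Vec; lookup; tabulate)
import Data.Vec.Properties as VecP
open import Function using (_∘_; _⇔_; mk⇔)
open import Relation.Binary.Definitions using (tri<; tri≈; tri>)
open import Relation.Binary.PropositionalEquality
open import Relation.Nullary using (¬_; does; yes; no; contradiction)
open import Relation.Unary using (Decidable)
open import Defs

module Lists where

  open import Data.Nat using (_+_)
  open import Data.List using (concatMap; cartesianProductWith)
  open import Data.List.Membership.Propositional.Properties.WithK using (unique∧set⇒bag)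
  open import Data.List.Relation.Binary.BagAndSetEquality using (∼bag⇒↭)

  concatMap-map : ∀ {A B C : Set} (f : A → B → C) xs ys → concatMap (λ x → map (f x) ys) xs ≡ cartesianProductWith f xs ys
  concatMap-map f [] ys = refl
  concatMap-map f (x ∷ xs) ys = cong (map (f x) ys ++_) (concatMap-map f xs ys)

  allVecs-unique : ∀ {A : Set} {xs : List A} k → Unique xs → Unique (allVecs xs k)
  allVecs-unique zero u = [] ∷ []
  allVecs-unique {xs = xs} (suc k) u =
    subst Unique (sym (concatMap-map Vec._∷_ xs (allVecs xs k)))
      (UniqueP.cartesianProductWith⁺ Vec._∷_ VecP.∷-injective u (allVecs-unique k u))

  ∈-allVecs : ∀ {A : Set} {xs : List A} {k} (v : Vec A k) → (∀ i → lookup v i ∈ xs) → v ∈ allVecs xs k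
  ∈-allVecs Vec.[] _ = here refl
  ∈-allVecs {xs = xs} {suc k} (x Vec.∷ v) v⊆xs =
    subst (_ ∈_) (sym (concatMap-map Vec._∷_ xs (allVecs xs k)))
      (∈-cartesianProductWith⁺ Vec._∷_ (v⊆xs zero) (∈-allVecs v (v⊆xs ∘ suc)))

  map-unique : ∀ {A B : Set} {f : A → B} {xs} → (∀ {x y} → x ∈ xs → y ∈ xs → f x ≡ f y → x ≡ y) →
               Unique xs → Unique (map f xs)
  map-unique {xs = []} _ [] = []
  map-unique {xs = x ∷ xs} inj (x∉xs ∷ u) =
    AllP.map⁺ (All.tabulate λ y∈xs fx≡fy → All.lookup x∉xs y∈xs (inj (here refl) (there y∈xs) fx≡fy))
    ∷ map-unique (λ x∈ y∈ → inj (there x∈) (there y∈)) u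

  unique-set⇒↭ : ∀ {A : Set} {xs ys : List A} → Unique xs → Unique ys → (∀ {x} → x ∈ xs ⇔ x ∈ ys) → xs ↭ ys
  unique-set⇒↭ u v xs≈ys = ∼bag⇒↭ (unique∧set⇒bag u v xs≈ys)

  module _ {A : Set} {P : A → Set} (P? : Decidable P) where

    length-filter-map : ∀ {B : Set} (f : B → A) xs → length (filter P? (map f xs)) ≡ length (filter (P? ∘ f) xs)
    length-filter-map f [] = refl
    length-filter-map f (x ∷ xs) with P? (f x)
    ... | yes _ = cong suc (length-filter-map f xs)
    ... | no _ = length-filter-map f xs

    length-filter-⊎ : ∀ {Q : A → Set} (Q? : Decidable Q) {xs} → All (λ x → P x ⊎ Q x) xs →
                      (∀ {x} → P x → ¬ Q x) → length (filter P? xs) + length (filter Q? xs) ≡ length xs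
    length-filter-⊎ Q? [] _ = refl
    length-filter-⊎ Q? {x ∷ xs} (px⊎qx ∷ rest) P⇒¬Q with ih ← length-filter-⊎ Q? rest P⇒¬Q | P? x | Q? x
    ... | yes px | yes qx = contradiction qx (P⇒¬Q px)
    ... | yes _  | no _   = cong suc ih
    ... | no _   | yes _  = trans (ℕP.+-suc _ _) (cong suc ih)
    ... | no ¬px | no ¬qx with px⊎qx
    ...   | inj₁ px = contradiction px ¬px
    ...   | inj₂ qx = contradiction qx ¬qx

open Lists

module BallotWords where

  open import Data.Nat using (_+_; _<_)
  open import Data.Fin.Properties using (_≟_)

  pattern row₁ = zero
  pattern row₂ = suc zero

  -- The row word of a tableau lists, for p = 1, 2, …, the row containing the entry p.
  Word : Set
  Word = List (Fin 2)

  count : Fin 2 → Word → ℕ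
  count r [] = 0
  count r (x ∷ w) = if does (r ≟ x) then suc (count r w) else count r w

  -- index r j w: the 0-based position in w of the (j+1)-th occurrence of r (junk if there is none).
  index : Fin 2 → ℕ → Word → ℕ
  index r j [] = 0
  index r j (x ∷ w) = if does (r ≟ x) then hit j else suc (index r j w)
    where
    hit : ℕ → ℕ
    hit zero = 0
    hit (suc j) = suc (index r j w)

  index-mono : ∀ r w {j j′} → j < j′ → j′ < count r w → index r j w < index r j′ w
  index-mono r (x ∷ w) {j} {j′} j<j′ j′<c with r ≟ x
  index-mono r (x ∷ w) {zero} {suc j′} _ _ | yes _ = s≤s z≤n
  index-mono r (x ∷ w) {suc j} {suc j′} (s≤s j<j′) (s≤s j′<c) | yes _ = s≤s (index-mono r w j<j′ j′<c)
  ... | no _ = s≤s (index-mono r w j<j′ j′<c)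

  index<length : ∀ r w {j} → j < count r w → index r j w < length w
  index<length r (x ∷ w) {j} j<c with r ≟ x
  index<length r (x ∷ w) {zero} _ | yes _ = s≤s z≤n
  index<length r (x ∷ w) {suc j} (s≤s j<c) | yes _ = s≤s (index<length r w j<c)
  ... | no _ = s≤s (index<length r w j<c)

  index-injective : ∀ w {r r′ j j′} → j < count r w → j′ < count r′ w →
                    index r j w ≡ index r′ j′ w → r ≡ r′ × j ≡ j′
  index-injective (x ∷ w) {r} {r′} {j} {j′} j<c j′<c′ eq with r ≟ x | r′ ≟ x
  index-injective (x ∷ w) {j = zero} {zero} _ _ _ | yes refl | yes refl = refl , refl
  index-injective (x ∷ w) {j = suc j} {suc j′} (s≤s j<c) (s≤s j′<c′) eq | yes refl | yes refl
    with refl , refl ← index-injective w j<c j′<c′ (ℕP.suc-injective eq) = refl , refl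
  index-injective (x ∷ w) {j = zero} {suc j′} _ _ () | yes refl | yes refl
  index-injective (x ∷ w) {j = suc j} {zero} _ _ () | yes refl | yes refl
  index-injective (x ∷ w) {j = zero} _ _ () | yes refl | no _
  index-injective (x ∷ w) {j = suc j} (s≤s j<c) j′<c′ eq | yes refl | no r′≢x
    with refl , _ ← index-injective w j<c j′<c′ (ℕP.suc-injective eq) = contradiction refl r′≢x
  index-injective (x ∷ w) {j′ = zero} _ _ () | no _ | yes refl
  index-injective (x ∷ w) {j′ = suc j′} j<c (s≤s j′<c′) eq | no r≢x | yes refl
    with refl , _ ← index-injective w j<c j′<c′ (ℕP.suc-injective eq) = contradiction refl r≢x
  ... | no _ | no _ = index-injective w j<c j′<c′ (ℕP.suc-injective eq)

  index-head : ∀ x w → 0 < count x (x ∷ w) × index x 0 (x ∷ w) ≡ 0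
  index-head x w with x ≟ x
  ... | yes _ = s≤s z≤n , refl
  ... | no x≢x = contradiction refl x≢x

  index-∷ : ∀ r x w {j} → j < count r w → ∃ λ j′ → j′ < count r (x ∷ w) × index r j′ (x ∷ w) ≡ suc (index r j w)
  index-∷ r x w {j} j<c with r ≟ x
  ... | yes _ = suc j , s≤s j<c , refl
  ... | no _ = j , j<c , refl

  index-surjective : ∀ w {p} → p < length w → ∃₂ λ r j → j < count r w × index r j w ≡ p
  index-surjective (x ∷ w) {zero} _ = x , 0 , index-head x w
  index-surjective (x ∷ w) {suc p} (s≤s p<n) with r , j , j<c , refl ← index-surjective w p<n
    with j′ , j′<c , eq ← index-∷ r x w j<c = r , j′ , j′<c , eq

  applyUpTo-index : ∀ (f : ℕ → Fin 2) m {r j} → j < count r (applyUpTo f m) → f (index r j (applyUpTo f m)) ≡ r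
  applyUpTo-index f (suc m) {r} {j} j<c with r ≟ f 0
  applyUpTo-index f (suc m) {j = zero} _ | yes r≡f0 = sym r≡f0
  applyUpTo-index f (suc m) {j = suc j} (s≤s j<c) | yes _ = applyUpTo-index (f ∘ suc) m j<c
  ... | no _ = applyUpTo-index (f ∘ suc) m j<c

  length-count : ∀ w → length w ≡ count row₁ w + count row₂ w
  length-count [] = refl
  length-count (row₁ ∷ w) = cong suc (length-count w)
  length-count (row₂ ∷ w) = trans (cong suc (length-count w)) (sym (ℕP.+-suc _ _))

  index-ext : ∀ w w′ → (∀ r → count r w ≡ count r w′) →
              (∀ r {j} → j < count r w → index r j w ≡ index r j w′) → w ≡ w′
  index-ext [] [] _ _ = refl
  index-ext [] (x ∷ w′) same-count _ = contradiction (same-count x) (ℕP.<⇒≢ (proj₁ (index-head x w′)))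
  index-ext (x ∷ w) [] same-count _ = contradiction (same-count x) (ℕP.<⇒≢ (proj₁ (index-head x w)) ∘ sym)
  index-ext (row₁ ∷ w) (row₁ ∷ w′) same-count same-index =
    cong (row₁ ∷_) (index-ext w w′
      (λ { row₁ → ℕP.suc-injective (same-count row₁) ; row₂ → same-count row₂ })
      (λ { row₁ j<c → ℕP.suc-injective (same-index row₁ (s≤s j<c)) ; row₂ j<c → ℕP.suc-injective (same-index row₂ j<c) }))
  index-ext (row₂ ∷ w) (row₂ ∷ w′) same-count same-index =
    cong (row₂ ∷_) (index-ext w w′
      (λ { row₁ → same-count row₁ ; row₂ → ℕP.suc-injective (same-count row₂) })
      (λ { row₁ j<c → ℕP.suc-injective (same-index row₁ j<c) ; row₂ j<c → ℕP.suc-injective (same-index row₂ (s≤s j<c)) }))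
  index-ext (row₁ ∷ w) (row₂ ∷ w′) _ same-index with () ← same-index row₁ (s≤s z≤n)
  index-ext (row₂ ∷ w) (row₁ ∷ w′) _ same-index with () ← same-index row₂ (s≤s z≤n)

  -- Ballot h w: starting from a surplus of h first-row letters, no prefix of w has more
  -- second-row than first-row letters, and the surplus at the end is 0.
  Ballot : ℕ → Word → Set
  Ballot h [] = h ≡ 0
  Ballot h (row₁ ∷ w) = Ballot (suc h) w
  Ballot zero (row₂ ∷ w) = ⊥
  Ballot (suc h) (row₂ ∷ w) = Ballot h w

  ballot-count : ∀ h w → Ballot h w → count row₂ w ≡ count row₁ w + h
  ballot-count h [] refl = refl
  ballot-count h (row₁ ∷ w) b = trans (ballot-count (suc h) w b) (ℕP.+-suc _ h)
  ballot-count (suc h) (row₂ ∷ w) b = trans (cong suc (ballot-count h w b)) (sym (ℕP.+-suc _ h))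

  ballot⇒columns : ∀ h w → Ballot h w → ∀ {j} → j < count row₁ w → index row₁ j w < index row₂ (j + h) w
  ballot⇒columns h (row₁ ∷ w) b {zero} _ = s≤s z≤n
  ballot⇒columns h (row₁ ∷ w) b {suc j} (s≤s j<c)
    rewrite sym (ℕP.+-suc j h) = s≤s (ballot⇒columns (suc h) w b j<c)
  ballot⇒columns (suc h) (row₂ ∷ w) b {j} j<c
    rewrite ℕP.+-suc j h = s≤s (ballot⇒columns h w b j<c)

  columns⇒ballot : ∀ h w → count row₂ w ≡ count row₁ w + h →
                  (∀ {j} → j < count row₁ w → index row₁ j w < index row₂ (j + h) w) → Ballot h w
  columns⇒ballot h [] c _ = sym c
  columns⇒ballot h (row₁ ∷ w) c col =
    columns⇒ballot (suc h) w (trans c (sym (ℕP.+-suc _ h)))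
      (λ {j} j<c → subst (λ k → index row₁ j w < index row₂ k w) (sym (ℕP.+-suc j h)) (ℕP.≤-pred (col (s≤s j<c))))
  columns⇒ballot zero (row₂ ∷ w) c col with count row₁ w
  ... | zero = contradiction c ℕP.1+n≢0
  ... | suc _ with () ← col {0} (s≤s z≤n)
  columns⇒ballot (suc h) (row₂ ∷ w) c col =
    columns⇒ballot h w (ℕP.suc-injective (trans c (ℕP.+-suc _ h)))
      (λ {j} j<c → ℕP.≤-pred (subst (λ k → suc (index row₁ j w) < index row₂ k (row₂ ∷ w)) (ℕP.+-suc j h) (col j<c)))

  ballotWords : ℕ → ℕ → List Word
  ballotWords zero zero = [] ∷ []
  ballotWords zero (suc h) = []
  ballotWords (suc r) zero = map (row₁ ∷_) (ballotWords r 1)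
  ballotWords (suc r) (suc h) = map (row₁ ∷_) (ballotWords r (suc (suc h))) ++ map (row₂ ∷_) (ballotWords r h)

  ∈-ballotWords⁺ : ∀ {r h w} → length w ≡ r → Ballot h w → w ∈ ballotWords r h
  ∈-ballotWords⁺ {zero} {zero} {[]} _ _ = here refl
  ∈-ballotWords⁺ {suc r} {zero} {row₁ ∷ w} refl b = ∈-map⁺ (row₁ ∷_) (∈-ballotWords⁺ refl b)
  ∈-ballotWords⁺ {suc r} {zero} {row₂ ∷ w} _ ()
  ∈-ballotWords⁺ {suc r} {suc h} {row₁ ∷ w} refl b = ∈-++⁺ˡ (∈-map⁺ (row₁ ∷_) (∈-ballotWords⁺ refl b))
  ∈-ballotWords⁺ {suc r} {suc h} {row₂ ∷ w} refl b = ∈-++⁺ʳ _ (∈-map⁺ (row₂ ∷_) (∈-ballotWords⁺ refl b))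

  ∈-ballotWords⁻ : ∀ r h {w} → w ∈ ballotWords r h → length w ≡ r × Ballot h w
  ∈-ballotWords⁻ zero zero (here refl) = refl , refl
  ∈-ballotWords⁻ (suc r) zero w∈ with w , w∈ , refl ← ∈-map⁻ (row₁ ∷_) w∈ =
    map₁ (cong suc) (∈-ballotWords⁻ r 1 w∈)
  ∈-ballotWords⁻ (suc r) (suc h) w∈ with ∈-++⁻ (map (row₁ ∷_) (ballotWords r (suc (suc h)))) w∈
  ... | inj₁ w∈₁ with w , w∈ , refl ← ∈-map⁻ (row₁ ∷_) w∈₁ = map₁ (cong suc) (∈-ballotWords⁻ r (suc (suc h)) w∈)
  ... | inj₂ w∈₂ with w , w∈ , refl ← ∈-map⁻ (row₂ ∷_) w∈₂ = map₁ (cong suc) (∈-ballotWords⁻ r h w∈)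

  ballotWords-unique : ∀ r h → Unique (ballotWords r h)
  ballotWords-unique zero zero = [] ∷ []
  ballotWords-unique zero (suc h) = []
  ballotWords-unique (suc r) zero = UniqueP.map⁺ LP.∷-injectiveʳ (ballotWords-unique r 1)
  ballotWords-unique (suc r) (suc h) =
    UniqueP.++⁺ (UniqueP.map⁺ LP.∷-injectiveʳ (ballotWords-unique r (suc (suc h))))
                (UniqueP.map⁺ LP.∷-injectiveʳ (ballotWords-unique r h)) different-heads
    where
    different-heads : ∀ {v} → v ∈ map (row₁ ∷_) _ × v ∈ map (row₂ ∷_) _ → ⊥
    different-heads (v∈₁ , v∈₂) with _ , _ , refl ← ∈-map⁻ (row₁ ∷_) v∈₁ | _ , _ , () ← ∈-map⁻ (row₂ ∷_) v∈₂

open BallotWords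

module Tableaux where

  open import Data.Nat using (_+_; _*_; _<_; _≤_; _<?_)
  open import Data.Nat.Induction using (<-rec)

  StrictlyIncreasing : ℕ → (ℕ → ℕ) → Set
  StrictlyIncreasing n f = ∀ {i j} → i < j → j < n → f i < f j

  ImageWithin : (ℕ → ℕ) → ℕ → (ℕ → ℕ) → ℕ → Set
  ImageWithin f n g c = ∀ {i} → i < n → ∃ λ j → j < c × f i ≡ g j

  private
    enumeration-≤ : ∀ {f g n c} → StrictlyIncreasing n f → StrictlyIncreasing c g → ImageWithin f n g c →
                    ∀ {i} → i < n → (∀ {j} → j < i → f j ≡ g j) → g i ≤ f i
    enumeration-≤ f-inc g-inc f⊆g {i} i<n earlier with j , j<c , fi≡gj ← f⊆g i<n | ℕP.<-cmp j i
    ... | tri< j<i _ _ = contradiction (trans (earlier j<i) (sym fi≡gj)) (ℕP.<⇒≢ (f-inc j<i i<n))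
    ... | tri≈ _ refl _ = ℕP.≤-reflexive (sym fi≡gj)
    ... | tri> _ _ i<j = ℕP.<⇒≤ (subst (_ <_) (sym fi≡gj) (g-inc i<j j<c))

    not-shorter : ∀ {f g n c} → StrictlyIncreasing c g → ImageWithin g c f n →
                  (∀ {i} → i < n → i < c → f i ≡ g i) → ¬ n < c
    not-shorter g-inc g⊆f agree n<c with i , i<n , gn≡fi ← g⊆f n<c =
      ℕP.<-irrefl (sym (trans gn≡fi (agree i<n (ℕP.<-trans i<n n<c)))) (g-inc i<n n<c)

  module IncreasingEnumerations {f g : ℕ → ℕ} {n c : ℕ}
    (f-inc : StrictlyIncreasing n f) (g-inc : StrictlyIncreasing c g)
    (f⊆g : ImageWithin f n g c) (g⊆f : ImageWithin g c f n) where

    agree : ∀ {i} → i < n → i < c → f i ≡ g i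
    agree {i} = <-rec (λ i → i < n → i < c → f i ≡ g i) step i
      where
      step : ∀ i → (∀ {j} → j < i → j < n → j < c → f j ≡ g j) → i < n → i < c → f i ≡ g i
      step i earlier i<n i<c = ℕP.≤-antisym
        (enumeration-≤ g-inc f-inc g⊆f i<c λ j<i → sym (earlier j<i (ℕP.<-trans j<i i<n) (ℕP.<-trans j<i i<c)))
        (enumeration-≤ f-inc g-inc f⊆g i<n λ j<i → earlier j<i (ℕP.<-trans j<i i<n) (ℕP.<-trans j<i i<c))

    same-length : n ≡ c
    same-length = ℕP.≤-antisym
      (ℕP.≮⇒≥ (not-shorter f-inc f⊆g λ i<c i<n → sym (agree i<n i<c)))
      (ℕP.≮⇒≥ (not-shorter g-inc g⊆f agree))

  tableau : (n : ℕ) → Word → Filling n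
  tableau n w = tabulate λ i → tabulate λ j → suc (index i (toℕ j) w)

  entry-tableau : ∀ n w i j → entry (tableau n w) (i , j) ≡ suc (index i (toℕ j) w)
  entry-tableau n w i j =
    trans (cong (λ row → lookup row j) (VecP.lookup∘tabulate (λ i → tabulate λ j → suc (index i (toℕ j) w)) i))
          (VecP.lookup∘tabulate (λ j → suc (index i (toℕ j) w)) j)

  tableau-≡ : ∀ {n} w (T : Filling n) → (∀ i j → suc (index i (toℕ j) w) ≡ entry T (i , j)) → tableau n w ≡ T
  tableau-≡ w T same = begin
    tableau _ w                                  ≡⟨ VecP.tabulate-cong (λ i → VecP.tabulate-cong (same i)) ⟩
    tabulate (λ i → tabulate (lookup (lookup T i))) ≡⟨ VecP.tabulate-cong (λ i → VecP.tabulate∘lookup (lookup T i)) ⟩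
    tabulate (lookup T)                          ≡⟨ VecP.tabulate∘lookup T ⟩
    T                                            ∎
    where open ≡-Reasoning

  count-balanced : ∀ {n} w → length w ≡ 2 * n → Ballot 0 w → ∀ r → count r w ≡ n
  count-balanced {n} w len b = λ { row₁ → count₁≡n ; row₂ → trans count₂≡count₁ count₁≡n }
    where
    count₂≡count₁ : count row₂ w ≡ count row₁ w
    count₂≡count₁ = trans (ballot-count 0 w b) (ℕP.+-identityʳ _)
    count₁≡n : count row₁ w ≡ n
    count₁≡n = ℕP.*-cancelˡ-≡ _ _ 2 (begin
      2 * count row₁ w                    ≡⟨ cong (count row₁ w +_) (ℕP.+-identityʳ _) ⟩
      count row₁ w + count row₁ w         ≡⟨ cong (count row₁ w +_) (sym count₂≡count₁) ⟩
      count row₁ w + count row₂ w         ≡⟨ sym (length-count w) ⟩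
      length w                            ≡⟨ len ⟩
      2 * n                               ∎)
      where open ≡-Reasoning

  tableau-isSYT : ∀ {n w} → length w ≡ 2 * n → Ballot 0 w → IsSYT (tableau n w)
  tableau-isSYT {n} {w} len b = record
    { inRange = λ i j → subst (λ e → 1 ℕ.≤ e × e ≤ 2 * n) (sym (entry-tableau n w i j))
                          (s≤s z≤n , subst (index i (toℕ j) w <_) len (index<length i w (below i j)))
    ; injective = λ i j i′ j′ eq → injective i j i′ j′ (index-injective w (below i j) (below i′ j′)
                     (ℕP.suc-injective (trans (sym (entry-tableau n w i j)) (trans eq (entry-tableau n w i′ j′)))))
    ; surjective = surjective
    ; rowsInc = λ i j j′ j<j′ → subst₂ _<_ (sym (entry-tableau n w i j)) (sym (entry-tableau n w i j′))
                   (s≤s (index-mono i w j<j′ (below i j′)))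
    ; colsInc = colsInc
    }
    where
    below : ∀ i (j : Fin n) → toℕ j < count i w
    below i j = subst (toℕ j <_) (sym (count-balanced w len b i)) (FinP.toℕ<n j)
    injective : ∀ i j i′ j′ → i ≡ i′ × toℕ j ≡ toℕ j′ → (i , j) ≡ (i′ , j′)
    injective i j i′ j′ (refl , eq) = cong (i ,_) (FinP.toℕ-injective eq)
    surjective : ∀ (v : Fin (2 * n)) → ∃ λ i → ∃ λ j → entry (tableau n w) (i , j) ≡ suc (toℕ v)
    surjective v with r , j , j<c , eq ← index-surjective w (subst (toℕ v <_) (sym len) (FinP.toℕ<n v)) =
      r , fromℕ< j<n , trans (entry-tableau n w r (fromℕ< j<n)) (cong suc (trans (cong (λ k → index r k w) (FinP.toℕ-fromℕ< j<n)) eq))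
      where j<n = subst (j <_) (count-balanced w len b r) j<c
    colsInc : ∀ i i′ j → i Fin.< i′ → entry (tableau n w) (i , j) < entry (tableau n w) (i′ , j)
    colsInc row₁ row₂ j _ = subst₂ _<_ (sym (entry-tableau n w row₁ j)) (sym (entry-tableau n w row₂ j))
      (s≤s (subst (λ k → index row₁ (toℕ j) w < index row₂ k w) (ℕP.+-identityʳ _) (ballot⇒columns 0 w b (below row₁ j))))
    colsInc row₁ row₁ j ()
    colsInc row₂ row₁ j ()
    colsInc row₂ row₂ j (s≤s ())

  rowOf : ∀ {n} → Filling n → ℕ → Fin 2
  rowOf T v = if does (FinP.any? λ j → entry T (row₁ , j) ℕP.≟ v) then row₁ else row₂

  rowWord : ∀ {n} → Filling n → Word
  rowWord {n} T = applyUpTo (λ p → rowOf T (suc p)) (2 * n)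

  -- Row r of T as a function on ℕ (junk value 0 beyond the last column).
  rowEntry : ∀ {n} → Filling n → Fin 2 → ℕ → ℕ
  rowEntry {n} T r i with i <? n
  ... | yes i<n = entry T (r , fromℕ< i<n)
  ... | no _ = 0

  rowEntry-< : ∀ {n} (T : Filling n) r {i} (i<n : i < n) → rowEntry T r i ≡ entry T (r , fromℕ< i<n)
  rowEntry-< {n} T r {i} i<n with i <? n
  ... | yes i<n′ = cong (λ lt → entry T (r , fromℕ< lt)) (ℕP.<-irrelevant i<n′ i<n)
  ... | no i≮n = contradiction i<n i≮n

  rowEntry-toℕ : ∀ {n} (T : Filling n) r j → rowEntry T r (toℕ j) ≡ entry T (r , j)
  rowEntry-toℕ T r j = trans (rowEntry-< T r (FinP.toℕ<n j)) (cong (λ k → entry T (r , k)) (FinP.fromℕ<-toℕ j _))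

  module _ {n : ℕ} {T : Filling n} (syt : IsSYT T) where
    open IsSYT syt

    private
      w = rowWord T

      rowOf-entry : ∀ i j → rowOf T (entry T (i , j)) ≡ i
      rowOf-entry i j with FinP.any? (λ j′ → entry T (row₁ , j′) ℕP.≟ entry T (i , j))
      ... | yes (j′ , eq) = cong proj₁ (injective row₁ j′ i j eq)
      rowOf-entry row₁ j | no none = contradiction (j , refl) none
      rowOf-entry row₂ j | no _ = refl

      letter-rowOf : ∀ {r j} → j < count r w → rowOf T (suc (index r j w)) ≡ r
      letter-rowOf = applyUpTo-index (λ p → rowOf T (suc p)) (2 * n)

      index<2n : ∀ {r j} → j < count r w → index r j w < 2 * n
      index<2n {r} j<c = subst (index r _ w <_) (LP.length-applyUpTo _ (2 * n)) (index<length r w j<c)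

      f-inc : ∀ r → StrictlyIncreasing n (rowEntry T r)
      f-inc r {i} {j} i<j j<n = subst₂ _<_ (sym (rowEntry-< T r i<n)) (sym (rowEntry-< T r j<n))
        (rowsInc r _ _ (subst₂ _<_ (sym (FinP.toℕ-fromℕ< i<n)) (sym (FinP.toℕ-fromℕ< j<n)) i<j))
        where i<n = ℕP.<-trans i<j j<n

      g-inc : ∀ r → StrictlyIncreasing (count r w) (λ j → suc (index r j w))
      g-inc r i<j j<c = s≤s (index-mono r w i<j j<c)

      f⊆g : ∀ r → ImageWithin (rowEntry T r) n (λ j → suc (index r j w)) (count r w)
      f⊆g r {i} i<n rewrite rowEntry-< T r i<n
        with entry T (r , fromℕ< i<n) | inRange r (fromℕ< i<n) | rowOf-entry r (fromℕ< i<n)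
      ... | suc p | _ , p<2n | rowOf≡r
        with r′ , j , j<c , refl ← index-surjective w (subst (p <_) (sym (LP.length-applyUpTo _ (2 * n))) p<2n)
        with refl ← trans (sym (letter-rowOf j<c)) rowOf≡r = j , j<c , refl

      g⊆f : ∀ r → ImageWithin (λ j → suc (index r j w)) (count r w) (rowEntry T r) n
      g⊆f r {j} j<c with surjective (fromℕ< (index<2n j<c))
      ... | i , j′ , eq rewrite FinP.toℕ-fromℕ< (index<2n j<c)
        with refl ← trans (sym (rowOf-entry i j′)) (trans (cong (rowOf T) eq) (letter-rowOf j<c)) =
        toℕ j′ , FinP.toℕ<n j′ , trans (sym eq) (sym (rowEntry-toℕ T r j′))

    module RowOfSYT (r : Fin 2) = IncreasingEnumerations (f-inc r) (g-inc r) (f⊆g r) (g⊆f r)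

    count-rowWord : ∀ r → count r (rowWord T) ≡ n
    count-rowWord r = sym (RowOfSYT.same-length r)

    private
      index-rowWord : ∀ r {j} → j < n → suc (index r j w) ≡ rowEntry T r j
      index-rowWord r j<n = sym (RowOfSYT.agree r j<n (subst (_ <_) (sym (count-rowWord r)) j<n))

    tableau-rowWord : tableau n (rowWord T) ≡ T
    tableau-rowWord = tableau-≡ w T λ i j → trans (index-rowWord i (FinP.toℕ<n j)) (rowEntry-toℕ T i j)

    rowWord-ballot : Ballot 0 (rowWord T)
    rowWord-ballot = columns⇒ballot 0 w
      (trans (count-rowWord row₂) (trans (sym (count-rowWord row₁)) (sym (ℕP.+-identityʳ _))))
      column
      where
      column : ∀ {j} → j < count row₁ w → index row₁ j w < index row₂ (j + 0) w
      column {j} j<c = ℕP.≤-pred (subst₂ _<_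
        (sym (trans (index-rowWord row₁ j<n) (rowEntry-< T row₁ j<n)))
        (sym (trans (cong (λ k → suc (index row₂ k w)) (ℕP.+-identityʳ j)) (trans (index-rowWord row₂ j<n) (rowEntry-< T row₂ j<n))))
        (colsInc row₁ row₂ (fromℕ< j<n) (s≤s z≤n)))
        where j<n = subst (j <_) (count-rowWord row₁) j<c

  private
    index-tableau : ∀ {n} w r {j} (j<n : j < n) → entry (tableau n w) (r , fromℕ< j<n) ≡ suc (index r j w)
    index-tableau {n} w r j<n = trans (entry-tableau n w r (fromℕ< j<n)) (cong (λ k → suc (index r k w)) (FinP.toℕ-fromℕ< j<n))

  tableau-injective : ∀ {n} w w′ → length w ≡ 2 * n → Ballot 0 w → length w′ ≡ 2 * n → Ballot 0 w′ →
                      tableau n w ≡ tableau n w′ → w ≡ w′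
  tableau-injective {n} w w′ len b len′ b′ eq = index-ext w w′ same-count same-index
    where
    same-count : ∀ r → count r w ≡ count r w′
    same-count r = trans (count-balanced {n} w len b r) (sym (count-balanced {n} w′ len′ b′ r))
    same-index : ∀ r {j} → j < count r w → index r j w ≡ index r j w′
    same-index r {j} j<c = ℕP.suc-injective (begin
      suc (index r j w)                    ≡⟨ sym (index-tableau w r j<n) ⟩
      entry (tableau n w) (r , fromℕ< j<n)  ≡⟨ cong (λ T → entry T (r , fromℕ< j<n)) eq ⟩
      entry (tableau n w′) (r , fromℕ< j<n) ≡⟨ index-tableau w′ r j<n ⟩
      suc (index r j w′)                   ∎)
      where
      open ≡-Reasoning
      j<n = subst (j <_) (count-balanced {n} w len b r) j<c

  ∈-SYT⁺ : ∀ {n} {T : Filling n} → IsSYT T → T ∈ SYT n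
  ∈-SYT⁺ {n} {T} syt =
    ∈-filter⁺ isSYT? {xs = allFillings n} (∈-allVecs {xs = allVecs (values n) n} T λ i → ∈-allVecs (lookup T i) (entry∈values i)) syt
    where
    entry∈values : ∀ i j → entry T (i , j) ∈ values n
    entry∈values i j with entry T (i , j) | IsSYT.inRange syt i j
    ... | suc p | _ , p<2n = ∈-map⁺ suc (∈-upTo⁺ p<2n)

  ∈-SYT⁻ : ∀ {n} {T : Filling n} → T ∈ SYT n → IsSYT T
  ∈-SYT⁻ {n} T∈ = proj₂ (∈-filter⁻ isSYT? {xs = allFillings n} T∈)

  SYT-unique : ∀ n → Unique (SYT n)
  SYT-unique n = UniqueP.filter⁺ isSYT?
    (allVecs-unique 2 (allVecs-unique n (UniqueP.map⁺ ℕP.suc-injective (UniqueP.upTo⁺ (2 * n)))))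

  SYT↭ballotWords : ∀ n → SYT n ↭ map (tableau n) (ballotWords (2 * n) 0)
  SYT↭ballotWords n = unique-set⇒↭ (SYT-unique n)
    (map-unique injective (ballotWords-unique (2 * n) 0))
    (mk⇔ to from)
    where
    injective : ∀ {w w′} → w ∈ ballotWords (2 * n) 0 → w′ ∈ ballotWords (2 * n) 0 → tableau n w ≡ tableau n w′ → w ≡ w′
    injective {w} {w′} w∈ w′∈ =
      uncurry (uncurry (tableau-injective w w′) (∈-ballotWords⁻ (2 * n) 0 w∈)) (∈-ballotWords⁻ (2 * n) 0 w′∈)
    to : ∀ {T} → T ∈ SYT n → T ∈ map (tableau n) (ballotWords (2 * n) 0)
    to {T} T∈ = let syt = ∈-SYT⁻ T∈ in
      subst (_∈ map (tableau n) (ballotWords (2 * n) 0)) (tableau-rowWord syt)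
        (∈-map⁺ (tableau n) (∈-ballotWords⁺ {w = rowWord T} (LP.length-applyUpTo _ (2 * n)) (rowWord-ballot syt)))
    from : ∀ {T} → T ∈ map (tableau n) (ballotWords (2 * n) 0) → T ∈ SYT n
    from T∈ with w , w∈ , refl ← ∈-map⁻ (tableau n) {xs = ballotWords (2 * n) 0} T∈ =
      ∈-SYT⁺ (uncurry (tableau-isSYT {n} {w}) (∈-ballotWords⁻ (2 * n) 0 w∈))

  count-SYT : ∀ n {P : Filling n → Set} (P? : Decidable P) →
              length (filter P? (SYT n)) ≡ length (filter (P? ∘ tableau n) (ballotWords (2 * n) 0))
  count-SYT n P? = trans (↭-length (filter-↭ P? (SYT↭ballotWords n))) (length-filter-map P? (tableau n) (ballotWords (2 * n) 0))

open Tableaux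

module Ballots where

  open import Data.Nat using (_+_; _*_; _<_; _<?_; s≤s⁻¹)
  open import Data.Nat.Tactic.RingSolver using (solve-∀)

  ballots : ℕ → ℕ → ℕ
  ballots zero zero = 1
  ballots zero (suc h) = 0
  ballots (suc r) zero = ballots r 1
  ballots (suc r) (suc h) = ballots r (suc (suc h)) + ballots r h

  length-ballotWords : ∀ r h → length (ballotWords r h) ≡ ballots r h
  length-ballotWords zero zero = refl
  length-ballotWords zero (suc h) = refl
  length-ballotWords (suc r) zero = trans (LP.length-map _ (ballotWords r 1)) (length-ballotWords r 1)
  length-ballotWords (suc r) (suc h) = begin
    length (map (row₁ ∷_) (ballotWords r (suc (suc h))) ++ map (row₂ ∷_) (ballotWords r h))
      ≡⟨ LP.length-++ (map (row₁ ∷_) (ballotWords r (suc (suc h)))) ⟩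
    length (map (row₁ ∷_) (ballotWords r (suc (suc h)))) + length (map (row₂ ∷_) (ballotWords r h))
      ≡⟨ cong₂ _+_ (LP.length-map _ (ballotWords r (suc (suc h)))) (LP.length-map _ (ballotWords r h)) ⟩
    length (ballotWords r (suc (suc h))) + length (ballotWords r h)
      ≡⟨ cong₂ _+_ (length-ballotWords r (suc (suc h))) (length-ballotWords r h) ⟩
    ballots r (suc (suc h)) + ballots r h ∎
    where open ≡-Reasoning

  -- In the tableau of w, the entry [2, d+1] is smaller than the entry [1, a+1].
  Inverted : ℕ → ℕ → Word → Set
  Inverted d a w = index row₂ d w < index row₁ a w

  inverted? : ∀ d a → Decidable (Inverted d a)
  inverted? d a w = index row₂ d w <? index row₁ a w

  invertedBallots : ℕ → ℕ → ℕ → ℕ → ℕ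
  invertedBallots zero h d a = 0
  invertedBallots (suc r) zero d zero = 0
  invertedBallots (suc r) zero d (suc a) = invertedBallots r 1 d a
  invertedBallots (suc r) (suc h) zero zero = ballots r h
  invertedBallots (suc r) (suc h) zero (suc a) = invertedBallots r (suc (suc h)) zero a + ballots r h
  invertedBallots (suc r) (suc h) (suc d) zero = invertedBallots r h d zero
  invertedBallots (suc r) (suc h) (suc d) (suc a) = invertedBallots r (suc (suc h)) (suc d) a + invertedBallots r h d (suc a)

  private
    #inverted : ℕ → ℕ → List Word → ℕ
    #inverted d a ws = length (filter (inverted? d a) ws)

    #inverted-row₁-zero : ∀ d ws → #inverted d 0 (map (row₁ ∷_) ws) ≡ 0
    #inverted-row₁-zero d ws = trans (length-filter-map (inverted? d 0) (row₁ ∷_) ws)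
      (cong length (LP.filter-none (inverted? d 0 ∘ (row₁ ∷_)) (All.universal (λ _ ()) ws)))

    #inverted-row₁-suc : ∀ d a ws → #inverted d (suc a) (map (row₁ ∷_) ws) ≡ #inverted d a ws
    #inverted-row₁-suc d a ws = trans (length-filter-map (inverted? d (suc a)) (row₁ ∷_) ws)
      (cong length (LP.filter-≐ (inverted? d (suc a) ∘ (row₁ ∷_)) (inverted? d a) (s≤s⁻¹ , s≤s) ws))

    #inverted-row₂-zero : ∀ a ws → #inverted 0 a (map (row₂ ∷_) ws) ≡ length ws
    #inverted-row₂-zero a ws = trans (length-filter-map (inverted? 0 a) (row₂ ∷_) ws)
      (cong length (LP.filter-all (inverted? 0 a ∘ (row₂ ∷_)) (All.universal (λ _ → s≤s z≤n) ws)))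

    #inverted-row₂-suc : ∀ d a ws → #inverted (suc d) a (map (row₂ ∷_) ws) ≡ #inverted d a ws
    #inverted-row₂-suc d a ws = trans (length-filter-map (inverted? (suc d) a) (row₂ ∷_) ws)
      (cong length (LP.filter-≐ (inverted? (suc d) a ∘ (row₂ ∷_)) (inverted? d a) (s≤s⁻¹ , s≤s) ws))

  length-filter-inverted : ∀ r h d a → length (filter (inverted? d a) (ballotWords r h)) ≡ invertedBallots r h d a
  length-filter-inverted zero zero d a = refl
  length-filter-inverted zero (suc h) d a = refl
  length-filter-inverted (suc r) zero d zero = #inverted-row₁-zero d (ballotWords r 1)
  length-filter-inverted (suc r) zero d (suc a) =
    trans (#inverted-row₁-suc d a (ballotWords r 1)) (length-filter-inverted r 1 d a)
  length-filter-inverted (suc r) (suc h) d a =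
    trans (cong length (LP.filter-++ (inverted? d a) (map (row₁ ∷_) ups) (map (row₂ ∷_) downs)))
          (trans (LP.length-++ (filter (inverted? d a) (map (row₁ ∷_) ups))) (split d a))
    where
    ups = ballotWords r (suc (suc h))
    downs = ballotWords r h
    split : ∀ d a → #inverted d a (map (row₁ ∷_) ups) + #inverted d a (map (row₂ ∷_) downs) ≡ invertedBallots (suc r) (suc h) d a
    split zero zero = cong₂ _+_ (#inverted-row₁-zero 0 ups) (trans (#inverted-row₂-zero 0 downs) (length-ballotWords r h))
    split zero (suc a) = cong₂ _+_ (trans (#inverted-row₁-suc 0 a ups) (length-filter-inverted r (suc (suc h)) 0 a))
                                   (trans (#inverted-row₂-zero (suc a) downs) (length-ballotWords r h))
    split (suc d) zero = cong₂ _+_ (#inverted-row₁-zero (suc d) ups)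
                                   (trans (#inverted-row₂-suc d 0 downs) (length-filter-inverted r h d 0))
    split (suc d) (suc a) = cong₂ _+_ (trans (#inverted-row₁-suc (suc d) a ups) (length-filter-inverted r (suc (suc h)) (suc d) a))
                                      (trans (#inverted-row₂-suc d (suc a) downs) (length-filter-inverted r h d (suc a)))

  invertedBallots-[2,2]<[1,5] : ∀ k → invertedBallots (10 + k) 0 1 4 ≡ 9 * ballots (4 + k) 2 + 5 * ballots (4 + k) 0
  -- invertedBallots (10 + k) 0 1 4 unfolds by computation to the left-hand side of collect, where
  -- a = ballots (4 + k) 2, b = ballots (4 + k) 0 and ballots (5 + k) 1 = ballots (6 + k) 0 = a + b.
  invertedBallots-[2,2]<[1,5] k = collect (ballots (4 + k) 2) (ballots (4 + k) 0)
    where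
    collect : ∀ a b → ((a + (a + (a + b))) + ((a + (a + b)) + (a + b))) + ((a + (a + b)) + (a + b)) ≡ 9 * a + 5 * b
    collect = solve-∀

open Ballots

module Catalan where

  open import Data.Nat using (_+_; _*_; _<_)
  open import Data.Nat.Tactic.RingSolver using (solve-∀)
  open ≡-Reasoning

  choose : ℕ → ℕ → ℕ
  choose n zero = 1
  choose zero (suc k) = 0
  choose (suc n) (suc k) = choose n k + choose n (suc k)

  choose-absorb : ∀ n k → choose (suc n) (suc k) * suc k ≡ suc n * choose n k
  choose-absorb zero zero = refl
  choose-absorb zero (suc k) = refl
  choose-absorb (suc n) zero = cong suc (choose-absorb n zero)
  choose-absorb (suc n) (suc k) = begin
    (choose (suc n) (suc k) + choose (suc n) (suc (suc k))) * suc (suc k)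
      ≡⟨ expand (choose (suc n) (suc k)) (choose (suc n) (suc (suc k))) k ⟩
    choose (suc n) (suc k) * suc k + choose (suc n) (suc k) + choose (suc n) (suc (suc k)) * suc (suc k)
      ≡⟨ cong₂ (λ x y → x + choose (suc n) (suc k) + y) (choose-absorb n k) (choose-absorb n (suc k)) ⟩
    suc n * choose n k + (choose n k + choose n (suc k)) + suc n * choose n (suc k)
      ≡⟨ collect n (choose n k) (choose n (suc k)) ⟩
    suc (suc n) * (choose n k + choose n (suc k)) ∎
    where
    expand : ∀ x y k → (x + y) * suc (suc k) ≡ x * suc k + x + y * suc (suc k)
    expand = solve-∀
    collect : ∀ n x y → suc n * x + (x + y) + suc n * y ≡ suc (suc n) * (x + y)
    collect = solve-∀

  choose-absorb′ : ∀ k d → choose (k + d) (suc k) * suc k ≡ d * choose (k + d) k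
  choose-absorb′ k d = ℕP.+-cancelʳ-≡ (choose (k + d) k * suc k) _ _ (begin
    choose (k + d) (suc k) * suc k + choose (k + d) k * suc k
      ≡⟨ sym (ℕP.*-distribʳ-+ (suc k) (choose (k + d) (suc k)) (choose (k + d) k)) ⟩
    (choose (k + d) (suc k) + choose (k + d) k) * suc k
      ≡⟨ cong (_* suc k) (ℕP.+-comm (choose (k + d) (suc k)) _) ⟩
    choose (suc (k + d)) (suc k) * suc k
      ≡⟨ choose-absorb (k + d) k ⟩
    suc (k + d) * choose (k + d) k
      ≡⟨ split k d (choose (k + d) k) ⟩
    d * choose (k + d) k + choose (k + d) k * suc k ∎)
    where
    split : ∀ k d x → suc (k + d) * x ≡ d * x + x * suc k
    split = solve-∀

  choose-central : ∀ q → choose (q + suc q) (suc q) ≡ choose (q + suc q) q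
  choose-central q = ℕP.*-cancelʳ-≡ _ _ (suc q) (trans (choose-absorb′ q (suc q)) (ℕP.*-comm (suc q) _))

  choose-small : ∀ n k → choose n (suc (k + n)) ≡ 0
  choose-small zero k = refl
  choose-small (suc n) k = cong₂ _+_ (trans (cong (choose n) (ℕP.+-suc k n)) (choose-small n k))
                                     (trans (cong (choose n ∘ suc) (ℕP.+-suc k n)) (choose-small n (suc k)))

  ballots-small : ∀ r h → r < h → ballots r h ≡ 0
  ballots-small zero (suc h) _ = refl
  ballots-small (suc r) (suc h) (s≤s r<h) =
    cong₂ _+_ (ballots-small r (suc (suc h)) (ℕP.m<n⇒m<1+n (ℕP.m<n⇒m<1+n r<h))) (ballots-small r h r<h)

  -- Reflection principle: the words of length r = 2p + h with p first-row letters that are not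
  -- ballot words from surplus h correspond to the words with p + h + 1 second-row letters.
  ballots-reflection : ∀ r p h → p + p + h ≡ r → ballots r h + choose r (suc (p + h)) ≡ choose r p
  ballots-reflection zero zero zero refl = refl
  ballots-reflection (suc r) zero (suc h) eq with refl ← ℕP.suc-injective eq = begin
    ballots r (suc (suc r)) + ballots r r + (choose r (suc r) + choose r (suc (suc r)))
      ≡⟨ cong₂ (λ x y → x + ballots r r + (choose r (suc r) + y))
               (ballots-small r (suc (suc r)) (ℕP.m<n⇒m<1+n ℕP.≤-refl)) (choose-small r 1) ⟩
    ballots r r + (choose r (suc r) + 0)
      ≡⟨ cong (ballots r r +_) (ℕP.+-identityʳ _) ⟩
    ballots r r + choose r (suc r)
      ≡⟨ ballots-reflection r 0 r refl ⟩
    1 ∎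
  ballots-reflection (suc r) (suc q) zero eq = begin
    ballots r 1 + (choose r (suc q + 0) + choose r (suc (suc q + 0)))
      ≡⟨ cong (λ k → ballots r 1 + (choose r k + choose r (suc k))) (ℕP.+-identityʳ (suc q)) ⟩
    ballots r 1 + (choose r (suc q) + choose r (suc (suc q)))
      ≡⟨ swap (ballots r 1) (choose r (suc q)) (choose r (suc (suc q))) ⟩
    (ballots r 1 + choose r (suc (suc q))) + choose r (suc q)
      ≡⟨ cong (λ k → ballots r 1 + choose r k + choose r (suc q)) (cong suc (sym (ℕP.+-comm q 1))) ⟩
    (ballots r 1 + choose r (suc (q + 1))) + choose r (suc q)
      ≡⟨ cong (_+ choose r (suc q)) (ballots-reflection r q 1 (ℕP.suc-injective (trans (shift q) eq))) ⟩
    choose r q + choose r (suc q) ∎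
    where
    swap : ∀ g x y → g + (x + y) ≡ (g + y) + x
    swap = solve-∀
    shift : ∀ q → suc (q + q + 1) ≡ suc q + suc q + 0
    shift = solve-∀
  ballots-reflection (suc r) (suc q) (suc h) eq = begin
    (ballots r (suc (suc h)) + ballots r h) + (choose r (suc q + suc h) + choose r (suc (suc q + suc h)))
      ≡⟨ cong (λ k → (ballots r (suc (suc h)) + ballots r h) + (choose r k + choose r (suc k))) (ℕP.+-suc (suc q) h) ⟩
    (ballots r (suc (suc h)) + ballots r h) + (choose r (suc (suc q + h)) + choose r (suc (suc (suc q + h))))
      ≡⟨ swap (ballots r (suc (suc h))) (ballots r h) (choose r (suc (suc q + h))) (choose r (suc (suc (suc q + h)))) ⟩
    (ballots r (suc (suc h)) + choose r (suc (suc (suc q + h)))) + (ballots r h + choose r (suc (suc q + h)))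
      ≡⟨ cong (λ k → (ballots r (suc (suc h)) + choose r (suc k)) + (ballots r h + choose r (suc (suc q + h))))
              (sym (trans (ℕP.+-suc q (suc h)) (cong suc (ℕP.+-suc q h)))) ⟩
    (ballots r (suc (suc h)) + choose r (suc (q + suc (suc h)))) + (ballots r h + choose r (suc (suc q + h)))
      ≡⟨ cong₂ _+_ (ballots-reflection r q (suc (suc h)) (ℕP.suc-injective (trans (shift₁ q h) eq)))
                   (ballots-reflection r (suc q) h (ℕP.suc-injective (trans (shift₂ q h) eq))) ⟩
    choose r q + choose r (suc q) ∎
    where
    swap : ∀ a b x y → (a + b) + (x + y) ≡ (a + y) + (b + x)
    swap = solve-∀
    shift₁ : ∀ q h → suc (q + q + suc (suc h)) ≡ suc q + suc q + suc h
    shift₁ = solve-∀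
    shift₂ : ∀ q h → suc (suc q + suc q + h) ≡ suc q + suc q + suc h
    shift₂ = solve-∀

  catalan : ℕ → ℕ
  catalan p = ballots (p + p) 0

  catalan-choose : ∀ p → catalan p * suc p ≡ choose (p + p) p
  catalan-choose p = ℕP.+-cancelʳ-≡ (p * choose (p + p) p) _ _ (begin
    catalan p * suc p + p * choose (p + p) p
      ≡⟨ cong (catalan p * suc p +_) (sym (choose-absorb′ p p)) ⟩
    catalan p * suc p + choose (p + p) (suc p) * suc p
      ≡⟨ sym (ℕP.*-distribʳ-+ (suc p) (catalan p) _) ⟩
    (catalan p + choose (p + p) (suc p)) * suc p
      ≡⟨ cong (λ k → (catalan p + choose (p + p) (suc k)) * suc p) (sym (ℕP.+-identityʳ p)) ⟩
    (catalan p + choose (p + p) (suc (p + 0))) * suc p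
      ≡⟨ cong (_* suc p) (ballots-reflection (p + p) p 0 (ℕP.+-identityʳ (p + p))) ⟩
    choose (p + p) p * suc p
      ≡⟨ ℕP.*-comm (choose (p + p) p) (suc p) ⟩
    choose (p + p) p + p * choose (p + p) p ∎)

  catalan-ratio : ∀ p → catalan (suc p) * (2 + p) ≡ (2 + 4 * p) * catalan p
  catalan-ratio p = ℕP.*-cancelʳ-≡ _ _ (suc p) (begin
    catalan (suc p) * (2 + p) * suc p       ≡⟨ cong (_* suc p) (catalan-choose (suc p)) ⟩
    choose (suc p + suc p) (suc p) * suc p  ≡⟨ central-ratio ⟩
    (2 + 4 * p) * choose (p + p) p          ≡⟨ cong ((2 + 4 * p) *_) (sym (catalan-choose p)) ⟩
    (2 + 4 * p) * (catalan p * suc p)       ≡⟨ sym (ℕP.*-assoc (2 + 4 * p) (catalan p) (suc p)) ⟩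
    (2 + 4 * p) * catalan p * suc p         ∎)
    where
    Z = choose (p + suc p) p
    Z-ratio : Z * suc p ≡ suc (p + p) * choose (p + p) p
    Z-ratio = begin
      Z * suc p                               ≡⟨ cong (_* suc p) (sym (choose-central p)) ⟩
      choose (p + suc p) (suc p) * suc p      ≡⟨ cong (λ k → choose k (suc p) * suc p) (ℕP.+-suc p p) ⟩
      choose (suc (p + p)) (suc p) * suc p    ≡⟨ choose-absorb (p + p) p ⟩
      suc (p + p) * choose (p + p) p          ∎
    rearrange : ∀ p z → suc (p + suc p) * z * suc p ≡ (2 * suc p) * (z * suc p)
    rearrange = solve-∀
    collect : ∀ p x → 2 * suc p * (suc (p + p) * x) ≡ (2 + 4 * p) * x * suc p
    collect = solve-∀
    central-ratio : choose (suc p + suc p) (suc p) * suc p ≡ (2 + 4 * p) * choose (p + p) p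
    central-ratio = ℕP.*-cancelʳ-≡ _ _ (suc p) (begin
      choose (suc p + suc p) (suc p) * suc p * suc p ≡⟨ cong (_* suc p) (choose-absorb (p + suc p) p) ⟩
      suc (p + suc p) * Z * suc p                    ≡⟨ rearrange p Z ⟩
      2 * suc p * (Z * suc p)                        ≡⟨ cong (2 * suc p *_) Z-ratio ⟩
      2 * suc p * (suc (p + p) * choose (p + p) p)   ≡⟨ collect p (choose (p + p) p) ⟩
      (2 + 4 * p) * choose (p + p) p * suc p         ∎)

  catalan-nonZero : ∀ p → NonZero (catalan p)
  catalan-nonZero zero = _
  catalan-nonZero (suc p) = ℕP.m*n≢0⇒m≢0 (catalan (suc p))
    {{subst NonZero (sym (catalan-ratio p)) (ℕP.m*n≢0 (2 + 4 * p) (catalan p) {{_}} {{catalan-nonZero p}})}}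

open Catalan

module SortingCounts where

  open import Data.Nat using (_+_; _*_; _<_; s≤s⁻¹)
  open import Data.Nat.Tactic.RingSolver using (solve-∀)
  open ≡-Reasoning

  length-SYT : ∀ n → length (SYT n) ≡ catalan n
  length-SYT n = begin
    length (SYT n)                                  ≡⟨ ↭-length (SYT↭ballotWords n) ⟩
    length (map (tableau n) (ballotWords (2 * n) 0)) ≡⟨ LP.length-map (tableau n) (ballotWords (2 * n) 0) ⟩
    length (ballotWords (2 * n) 0)                  ≡⟨ length-ballotWords (2 * n) 0 ⟩
    ballots (n + (n + 0)) 0                         ≡⟨ cong (λ k → ballots (n + k) 0) (ℕP.+-identityʳ n) ⟩
    catalan n                                       ∎

  module _ (m : ℕ) where

    c₁₅ c₂₂ : Cell (5 + m)
    c₁₅ = row₁ , suc (suc (suc (suc zero)))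
    c₂₂ = row₂ , suc zero

    countGreater-[2,2]<[1,5] : countGreater (5 + m) c₁₅ c₂₂ ≡ invertedBallots (10 + (m + m)) 0 1 4
    countGreater-[2,2]<[1,5] = begin
      countGreater (5 + m) c₁₅ c₂₂
        ≡⟨ count-SYT (5 + m) [2,2]<[1,5]? ⟩
      length (filter (λ w → [2,2]<[1,5]? (tableau (5 + m) w)) (ballotWords (2 * (5 + m)) 0))
        ≡⟨ cong length (LP.filter-≐ _ (inverted? 1 4) (s≤s⁻¹ , s≤s) (ballotWords (2 * (5 + m)) 0)) ⟩
      length (filter (inverted? 1 4) (ballotWords (2 * (5 + m)) 0))
        ≡⟨ length-filter-inverted (2 * (5 + m)) 0 1 4 ⟩
      invertedBallots (2 * (5 + m)) 0 1 4
        ≡⟨ cong (λ r → invertedBallots r 0 1 4) (double m) ⟩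
      invertedBallots (10 + (m + m)) 0 1 4 ∎
      where
      [2,2]<[1,5]? = λ (T : Filling (5 + m)) → entry T c₂₂ ℕP.<? entry T c₁₅
      double : ∀ m → 2 * (5 + m) ≡ 10 + (m + m)
      double = solve-∀

    countGreater-catalan : countGreater (5 + m) c₁₅ c₂₂ + 4 * catalan (2 + m) ≡ 9 * catalan (3 + m)
    countGreater-catalan = begin
      countGreater (5 + m) c₁₅ c₂₂ + 4 * catalan (2 + m)
        ≡⟨ cong₂ _+_ (trans countGreater-[2,2]<[1,5] (invertedBallots-[2,2]<[1,5] (m + m)))
                     (cong (λ r → 4 * ballots r 0) (shift 2 m)) ⟩
      9 * ballots (4 + (m + m)) 2 + 5 * ballots (4 + (m + m)) 0 + 4 * ballots (4 + (m + m)) 0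
        ≡⟨ collect (ballots (4 + (m + m)) 2) (ballots (4 + (m + m)) 0) ⟩
      9 * ballots (6 + (m + m)) 0
        ≡⟨ cong (λ r → 9 * ballots r 0) (sym (shift 3 m)) ⟩
      9 * catalan (3 + m) ∎
      where
      shift : ∀ k m → (k + m) + (k + m) ≡ (k + k) + (m + m)
      shift = solve-∀
      collect : ∀ a b → 9 * a + 5 * b + 4 * b ≡ 9 * (a + b)
      collect = solve-∀

    countGreater-total : countGreater (5 + m) c₁₅ c₂₂ + countGreater (5 + m) c₂₂ c₁₅ ≡ length (SYT (5 + m))
    countGreater-total = length-filter-⊎ (λ T → entry T c₂₂ ℕP.<? entry T c₁₅) (λ T → entry T c₁₅ ℕP.<? entry T c₂₂)
      (All.tabulate λ T∈ → comparable (∈-SYT⁻ T∈)) ℕP.<-asym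
      where
      comparable : ∀ {T} → IsSYT T → entry T c₂₂ < entry T c₁₅ ⊎ entry T c₁₅ < entry T c₂₂
      comparable {T} syt with ℕP.<-cmp (entry T c₂₂) (entry T c₁₅)
      ... | tri< c₂₂<c₁₅ _ _ = inj₁ c₂₂<c₁₅
      ... | tri≈ _ eq _ with () ← IsSYT.injective syt row₂ (suc zero) row₁ (suc (suc (suc (suc zero)))) eq
      ... | tri> _ _ c₁₅<c₂₂ = inj₂ c₁₅<c₂₂

  NUM DEN : ℕ → ℕ
  NUM m = 45 * m * m + 315 * m + 480
  DEN m = 2 * (5 + 2 * m) * (9 + 2 * m) * (7 + 2 * m)

  catalan-ratio³ : ∀ m → catalan (5 + m) * (6 + m) * (5 + m) * (4 + m) ≡ 4 * DEN m * catalan (2 + m)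
  catalan-ratio³ m = begin
    catalan (5 + m) * (6 + m) * (5 + m) * (4 + m)
      ≡⟨ cong (λ x → x * (5 + m) * (4 + m)) (catalan-ratio (4 + m)) ⟩
    (2 + 4 * (4 + m)) * catalan (4 + m) * (5 + m) * (4 + m)
      ≡⟨ cong (_* (4 + m)) (ℕP.*-assoc (2 + 4 * (4 + m)) (catalan (4 + m)) (5 + m)) ⟩
    (2 + 4 * (4 + m)) * (catalan (4 + m) * (5 + m)) * (4 + m)
      ≡⟨ cong (λ x → (2 + 4 * (4 + m)) * x * (4 + m)) (catalan-ratio (3 + m)) ⟩
    (2 + 4 * (4 + m)) * ((2 + 4 * (3 + m)) * catalan (3 + m)) * (4 + m)
      ≡⟨ regroup (2 + 4 * (4 + m)) (2 + 4 * (3 + m)) (catalan (3 + m)) (4 + m) ⟩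
    (2 + 4 * (4 + m)) * (2 + 4 * (3 + m)) * (catalan (3 + m) * (4 + m))
      ≡⟨ cong ((2 + 4 * (4 + m)) * (2 + 4 * (3 + m)) *_) (catalan-ratio (2 + m)) ⟩
    (2 + 4 * (4 + m)) * (2 + 4 * (3 + m)) * ((2 + 4 * (2 + m)) * catalan (2 + m))
      ≡⟨ collect m (catalan (2 + m)) ⟩
    4 * DEN m * catalan (2 + m) ∎
    where
    regroup : ∀ x y a z → x * (y * a) * z ≡ x * y * (a * z)
    regroup = solve-∀
    collect : ∀ m c → (2 + 4 * (4 + m)) * (2 + 4 * (3 + m)) * ((2 + 4 * (2 + m)) * c)
                      ≡ 4 * (2 * (5 + 2 * m) * (9 + 2 * m) * (7 + 2 * m)) * c
    collect = solve-∀

  -- For n = m + 5 and g the number of tableaux with T[2,2] < T[1,5], this says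
  -- 2g / C(n) = 1 + NUM m / DEN m.
  sorting-identity : ∀ m g → g + 4 * catalan (2 + m) ≡ 9 * catalan (3 + m) →
                     2 * g * DEN m ≡ (NUM m + DEN m) * catalan (5 + m)
  sorting-identity m g g-relation =
    ℕP.*-cancelʳ-≡ _ _ (6 + m) (ℕP.*-cancelʳ-≡ _ _ (5 + m) (ℕP.*-cancelʳ-≡ _ _ (4 + m) (begin
      2 * g * DEN m * (6 + m) * (5 + m) * (4 + m)         ≡⟨ regroup₁ g (DEN m) m ⟩
      2 * DEN m * (g * (6 + m) * (5 + m) * (4 + m))       ≡⟨ cong (2 * DEN m *_) g-scaled ⟩
      2 * DEN m * (2 * (NUM m + DEN m) * c)               ≡⟨ regroup₂ (NUM m) (DEN m) c ⟩
      (NUM m + DEN m) * (4 * DEN m * c)                   ≡⟨ cong ((NUM m + DEN m) *_) (sym (catalan-ratio³ m)) ⟩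
      (NUM m + DEN m) * (N * (6 + m) * (5 + m) * (4 + m)) ≡⟨ regroup₃ (NUM m + DEN m) N m ⟩
      (NUM m + DEN m) * N * (6 + m) * (5 + m) * (4 + m)   ∎)))
    where
    c = catalan (2 + m)
    A = catalan (3 + m)
    N = catalan (5 + m)
    regroup₁ : ∀ g d m → 2 * g * d * (6 + m) * (5 + m) * (4 + m) ≡ 2 * d * (g * (6 + m) * (5 + m) * (4 + m))
    regroup₁ = solve-∀
    regroup₂ : ∀ u d c → 2 * d * (2 * (u + d) * c) ≡ (u + d) * (4 * d * c)
    regroup₂ = solve-∀
    regroup₃ : ∀ s N m → s * (N * (6 + m) * (5 + m) * (4 + m)) ≡ s * N * (6 + m) * (5 + m) * (4 + m)
    regroup₃ = solve-∀
    regroup₄ : ∀ A m → 9 * A * (6 + m) * (5 + m) * (4 + m) ≡ 9 * (6 + m) * (5 + m) * (A * (4 + m))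
    regroup₄ = solve-∀
    factor : ∀ x y m → x * (6 + m) * (5 + m) * (4 + m) + y * (6 + m) * (5 + m) * (4 + m)
                       ≡ (x + y) * (6 + m) * (5 + m) * (4 + m)
    factor = solve-∀
    expand-9A : ∀ m c → 9 * (6 + m) * (5 + m) * ((2 + 4 * (2 + m)) * c)
      ≡ 2 * ((45 * m * m + 315 * m + 480) + 2 * (5 + 2 * m) * (9 + 2 * m) * (7 + 2 * m)) * c
        + 4 * c * (6 + m) * (5 + m) * (4 + m)
    expand-9A = solve-∀
    g-scaled : g * (6 + m) * (5 + m) * (4 + m) ≡ 2 * (NUM m + DEN m) * c
    g-scaled = ℕP.+-cancelʳ-≡ (4 * c * (6 + m) * (5 + m) * (4 + m)) _ _ (begin
      g * (6 + m) * (5 + m) * (4 + m) + 4 * c * (6 + m) * (5 + m) * (4 + m)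
        ≡⟨ factor g (4 * c) m ⟩
      (g + 4 * c) * (6 + m) * (5 + m) * (4 + m)
        ≡⟨ cong (λ x → x * (6 + m) * (5 + m) * (4 + m)) g-relation ⟩
      9 * A * (6 + m) * (5 + m) * (4 + m)
        ≡⟨ regroup₄ A m ⟩
      9 * (6 + m) * (5 + m) * (A * (4 + m))
        ≡⟨ cong (9 * (6 + m) * (5 + m) *_) (catalan-ratio (2 + m)) ⟩
      9 * (6 + m) * (5 + m) * ((2 + 4 * (2 + m)) * c)
        ≡⟨ expand-9A m c ⟩
      2 * (NUM m + DEN m) * c + 4 * c * (6 + m) * (5 + m) * (4 + m) ∎)

  sorting-identity-SYT : ∀ m →
    2 * countGreater (5 + m) (c₁₅ m) (c₂₂ m) * DEN m ≡ (NUM m + DEN m) * length (SYT (5 + m))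
  sorting-identity-SYT m =
    subst (λ N → 2 * countGreater (5 + m) (c₁₅ m) (c₂₂ m) * DEN m ≡ (NUM m + DEN m) * N) (sym (length-SYT (5 + m)))
    (sorting-identity m (countGreater (5 + m) (c₁₅ m) (c₂₂ m)) (countGreater-catalan m))

open SortingCounts

open import Data.Integer as ℤ using ()
import Data.Integer.Properties as ℤP
import Data.Nat.Coprimality as Coprimality
import Data.Nat.Tactic.RingSolver as ℕSolver
open import Data.Rational as ℚ using (ℚ; mkℚ; 0ℚ; 1ℚ; _+_; _-_; _*_; _≤_; _⊓_; ∣_∣; 1/_)
import Data.Rational.Properties as ℚP
open import Level using (0ℓ)
open import Relation.Nullary.Decidable using (dec⇒maybe)
open import Tactic.RingSolver using (solve-∀)
import Tactic.RingSolver.Core.AlmostCommutativeRing as ACR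

module RationalArithmetic where

  -- The zero test lets the solver discard monomials whose coefficients cancel.
  ℚ-ring : ACR.AlmostCommutativeRing 0ℓ 0ℓ
  ℚ-ring = ACR.fromCommutativeRing ℚP.+-*-commutativeRing (λ x → dec⇒maybe (0ℚ ℚP.≟ x))

  -- ℕ→ℚ k normalises + k / 1, which does not compute for a variable k.
  private
    ℕ→ℚ-mkℚ : ∀ k → ℕ→ℚ k ≡ mkℚ (ℤ.+ k) 0 (Coprimality.sym (Coprimality.1-coprimeTo k))
    ℕ→ℚ-mkℚ k = ℚP.normalize-coprime _

  ℕ→ℚ-+ : ∀ a b → ℕ→ℚ (a ℕ.+ b) ≡ ℕ→ℚ a + ℕ→ℚ b
  ℕ→ℚ-+ a b rewrite ℕ→ℚ-mkℚ a | ℕ→ℚ-mkℚ b =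
    cong (ℚ._/ 1) (sym (cong₂ ℤ._+_ (ℤP.*-identityʳ (ℤ.+ a)) (ℤP.*-identityʳ (ℤ.+ b))))

  ℕ→ℚ-* : ∀ a b → ℕ→ℚ (a ℕ.* b) ≡ ℕ→ℚ a * ℕ→ℚ b
  ℕ→ℚ-* a b rewrite ℕ→ℚ-mkℚ a | ℕ→ℚ-mkℚ b = cong (ℚ._/ 1) (ℤP.pos-* a b)

  ℕ→ℚ-mono-≤ : ∀ {a b} → a ℕ.≤ b → ℕ→ℚ a ≤ ℕ→ℚ b
  ℕ→ℚ-mono-≤ {a} {b} a≤b rewrite ℕ→ℚ-mkℚ a | ℕ→ℚ-mkℚ b =
    ℚ.*≤* (subst₂ ℤ._≤_ (sym (ℤP.*-identityʳ (ℤ.+ a))) (sym (ℤP.*-identityʳ (ℤ.+ b))) (ℤ.+≤+ a≤b))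

  ℕ→ℚ-positive : ∀ k .{{_ : NonZero k}} → ℚ.Positive (ℕ→ℚ k)
  ℕ→ℚ-positive (suc k) rewrite ℕ→ℚ-mkℚ (suc k) = _

  ℕ→ℚ-≢0 : ∀ k .{{_ : NonZero k}} → ℕ→ℚ k ≢ 0ℚ
  ℕ→ℚ-≢0 (suc k) rewrite ℕ→ℚ-mkℚ (suc k) = λ ()

  ℕ→ℚ-quadratic : ∀ a b c m →
                  ℕ→ℚ (a ℕ.* m ℕ.* m ℕ.+ b ℕ.* m ℕ.+ c) ≡ ℕ→ℚ a * ℕ→ℚ m * ℕ→ℚ m + ℕ→ℚ b * ℕ→ℚ m + ℕ→ℚ c
  ℕ→ℚ-quadratic a b c m = begin
    ℕ→ℚ (a ℕ.* m ℕ.* m ℕ.+ b ℕ.* m ℕ.+ c)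
      ≡⟨ ℕ→ℚ-+ (a ℕ.* m ℕ.* m ℕ.+ b ℕ.* m) c ⟩
    ℕ→ℚ (a ℕ.* m ℕ.* m ℕ.+ b ℕ.* m) + ℕ→ℚ c
      ≡⟨ cong (_+ ℕ→ℚ c) (ℕ→ℚ-+ (a ℕ.* m ℕ.* m) (b ℕ.* m)) ⟩
    ℕ→ℚ (a ℕ.* m ℕ.* m) + ℕ→ℚ (b ℕ.* m) + ℕ→ℚ c
      ≡⟨ cong₂ (λ u v → u + v + ℕ→ℚ c) (trans (ℕ→ℚ-* (a ℕ.* m) m) (cong (_* ℕ→ℚ m) (ℕ→ℚ-* a m))) (ℕ→ℚ-* b m) ⟩
    ℕ→ℚ a * ℕ→ℚ m * ℕ→ℚ m + ℕ→ℚ b * ℕ→ℚ m + ℕ→ℚ c ∎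
    where open ≡-Reasoning

  ℕ→ℚ-cubic : ∀ a m → ℕ→ℚ (a ℕ.* m ℕ.* m ℕ.* m) ≡ ℕ→ℚ a * ℕ→ℚ m * ℕ→ℚ m * ℕ→ℚ m
  ℕ→ℚ-cubic a m = trans (ℕ→ℚ-* (a ℕ.* m ℕ.* m) m) (cong (_* ℕ→ℚ m) (trans (ℕ→ℚ-* (a ℕ.* m) m) (cong (_* ℕ→ℚ m) (ℕ→ℚ-* a m))))

  module _ {y : ℚ} (y≢0 : y ≢ 0ℚ) where
    open ≡-Reasoning

    private
      instance
        y-nonZero : ℚ.NonZero y
        y-nonZero = ℚ.≢-nonZero y≢0

      ÷?-≡-* : ∀ x → x ÷? y ≡ x * 1/ y
      ÷?-≡-* x with y ℚP.≟ 0ℚ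
      ... | yes y≡0 = contradiction y≡0 y≢0
      ... | no _ = refl

    ÷?-*-cancel : ∀ x → (x ÷? y) * y ≡ x
    ÷?-*-cancel x = begin
      (x ÷? y) * y      ≡⟨ cong (_* y) (÷?-≡-* x) ⟩
      x * 1/ y * y      ≡⟨ ℚP.*-assoc x (1/ y) y ⟩
      x * (1/ y * y)    ≡⟨ cong (x *_) (ℚP.*-inverseˡ y) ⟩
      x * 1ℚ            ≡⟨ ℚP.*-identityʳ x ⟩
      x                 ∎

    ÷?-unique : ∀ {x z} → z * y ≡ x → z ≡ x ÷? y
    ÷?-unique {x} {z} z*y≡x = begin
      z                 ≡⟨ sym (ℚP.*-identityʳ z) ⟩
      z * 1ℚ            ≡⟨ cong (z *_) (sym (ℚP.*-inverseʳ y)) ⟩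
      z * (y * 1/ y)    ≡⟨ sym (ℚP.*-assoc z y (1/ y)) ⟩
      z * y * 1/ y      ≡⟨ cong (_* 1/ y) z*y≡x ⟩
      x * 1/ y          ≡⟨ sym (÷?-≡-* x) ⟩
      x ÷? y            ∎

    *-cancelʳ : ∀ {a b} → a * y ≡ b * y → a ≡ b
    *-cancelʳ {a} {b} eq = trans (÷?-unique eq) (sym (÷?-unique refl))

    *-1÷? : ∀ c → c * (ℕ→ℚ 1 ÷? y) ≡ c ÷? y
    *-1÷? c = ÷?-unique (trans (ℚP.*-assoc c _ y) (trans (cong (c *_) (÷?-*-cancel (ℕ→ℚ 1))) (ℚP.*-identityʳ c)))

  ÷?-mono-ℕ : ∀ a b c d .{{_ : NonZero b}} .{{_ : NonZero d}} → a ℕ.* d ℕ.≤ c ℕ.* b →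
              ℕ→ℚ a ÷? ℕ→ℚ b ≤ ℕ→ℚ c ÷? ℕ→ℚ d
  ÷?-mono-ℕ a b c d ad≤cb = ℚP.*-cancelʳ-≤-pos (ℕ→ℚ (b ℕ.* d)) {{ℕ→ℚ-positive (b ℕ.* d) {{ℕP.m*n≢0 b d}}}}
    (subst₂ _≤_ (sym (scaled a b d))
                (sym (trans (cong (λ k → (ℕ→ℚ c ÷? ℕ→ℚ d) * ℕ→ℚ k) (ℕP.*-comm b d)) (scaled c d b)))
                (ℕ→ℚ-mono-≤ ad≤cb))
    where
    open ≡-Reasoning
    scaled : ∀ x y z .{{_ : NonZero y}} → (ℕ→ℚ x ÷? ℕ→ℚ y) * ℕ→ℚ (y ℕ.* z) ≡ ℕ→ℚ (x ℕ.* z)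
    scaled x y z = begin
      (ℕ→ℚ x ÷? ℕ→ℚ y) * ℕ→ℚ (y ℕ.* z)       ≡⟨ cong ((ℕ→ℚ x ÷? ℕ→ℚ y) *_) (ℕ→ℚ-* y z) ⟩
      (ℕ→ℚ x ÷? ℕ→ℚ y) * (ℕ→ℚ y * ℕ→ℚ z)     ≡⟨ sym (ℚP.*-assoc (ℕ→ℚ x ÷? ℕ→ℚ y) (ℕ→ℚ y) (ℕ→ℚ z)) ⟩
      (ℕ→ℚ x ÷? ℕ→ℚ y) * ℕ→ℚ y * ℕ→ℚ z       ≡⟨ cong (_* ℕ→ℚ z) (÷?-*-cancel (ℕ→ℚ-≢0 y) (ℕ→ℚ x)) ⟩
      ℕ→ℚ x * ℕ→ℚ z                           ≡⟨ sym (ℕ→ℚ-* x z) ⟩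
      ℕ→ℚ (x ℕ.* z)                           ∎

  ÷?-nonNeg : ∀ a b .{{_ : NonZero b}} → 0ℚ ≤ ℕ→ℚ a ÷? ℕ→ℚ b
  ÷?-nonNeg a b = ÷?-mono-ℕ 0 1 a b ℕ.z≤n

  *-≢0 : ∀ {a b} → a ≢ 0ℚ → b ≢ 0ℚ → a * b ≢ 0ℚ
  *-≢0 {a} {b} a≢0 b≢0 ab≡0 = a≢0 (trans (÷?-unique b≢0 ab≡0) (sym (÷?-unique b≢0 (ℚP.*-zeroˡ b))))

open RationalArithmetic

module ClosedForm where

  SYT-nonZero : ∀ n → NonZero (length (SYT n))
  SYT-nonZero n = subst NonZero (sym (length-SYT n)) (catalan-nonZero n)

  SP≡NUM/DEN : ∀ m → SP (5 ℕ.+ m) (c₁₅ m) (c₂₂ m) ≡ ℕ→ℚ (NUM m) ÷? ℕ→ℚ (DEN m)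
  SP≡NUM/DEN m = ÷?-unique (ℕ→ℚ-≢0 (DEN m)) (*-cancelʳ N≢0 (begin
    (G ÷? ℕ→ℚ N - L ÷? ℕ→ℚ N) * D * ℕ→ℚ N
      ≡⟨ distribute (G ÷? ℕ→ℚ N) (L ÷? ℕ→ℚ N) D (ℕ→ℚ N) ⟩
    ((G ÷? ℕ→ℚ N) * ℕ→ℚ N - (L ÷? ℕ→ℚ N) * ℕ→ℚ N) * D
      ≡⟨ cong₂ (λ a b → (a - b) * D) (÷?-*-cancel N≢0 G) (÷?-*-cancel N≢0 L) ⟩
    (G - L) * D
      ≡⟨ regroup G L D ⟩
    ℕ→ℚ 2 * G * D - (G + L) * D
      ≡⟨ cong₂ (λ a b → a - b * D) two-G-D G+L ⟩
    (U + D) * ℕ→ℚ N - ℕ→ℚ N * D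
      ≡⟨ cancel U D (ℕ→ℚ N) ⟩
    U * ℕ→ℚ N ∎))
    where
    open ≡-Reasoning
    n = 5 ℕ.+ m
    g = countGreater n (c₁₅ m) (c₂₂ m)
    l = countGreater n (c₂₂ m) (c₁₅ m)
    N = length (SYT n)
    G = ℕ→ℚ g
    L = ℕ→ℚ l
    U = ℕ→ℚ (NUM m)
    D = ℕ→ℚ (DEN m)
    N≢0 = ℕ→ℚ-≢0 N {{SYT-nonZero n}}
    G+L : G + L ≡ ℕ→ℚ N
    G+L = trans (sym (ℕ→ℚ-+ g l)) (cong ℕ→ℚ (countGreater-total m))
    two-G-D : ℕ→ℚ 2 * G * D ≡ (U + D) * ℕ→ℚ N
    two-G-D = begin
      ℕ→ℚ 2 * G * D                 ≡⟨ cong (_* D) (sym (ℕ→ℚ-* 2 g)) ⟩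
      ℕ→ℚ (2 ℕ.* g) * D             ≡⟨ sym (ℕ→ℚ-* (2 ℕ.* g) (DEN m)) ⟩
      ℕ→ℚ (2 ℕ.* g ℕ.* DEN m)       ≡⟨ cong ℕ→ℚ (sorting-identity-SYT m) ⟩
      ℕ→ℚ ((NUM m ℕ.+ DEN m) ℕ.* N)  ≡⟨ ℕ→ℚ-* (NUM m ℕ.+ DEN m) N ⟩
      ℕ→ℚ (NUM m ℕ.+ DEN m) * ℕ→ℚ N  ≡⟨ cong (_* ℕ→ℚ N) (ℕ→ℚ-+ (NUM m) (DEN m)) ⟩
      (U + D) * ℕ→ℚ N               ∎
    distribute : ∀ a b d y → (a - b) * d * y ≡ (a * y - b * y) * d
    distribute = solve-∀ ℚ-ring
    regroup : ∀ g l d → (g - l) * d ≡ ℕ→ℚ 2 * g * d - (g + l) * d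
    regroup = solve-∀ ℚ-ring
    cancel : ∀ u d y → (u + d) * y - y * d ≡ u * y
    cancel = solve-∀ ℚ-ring

  numerator denominator : ℚ → ℚ
  numerator x = ℕ→ℚ 45 * x * x - ℕ→ℚ 135 * x + ℕ→ℚ 30
  denominator x = ℕ→ℚ 2 * (ℕ→ℚ 2 * x - ℕ→ℚ 5) * (ℕ→ℚ 2 * x - ℕ→ℚ 1) * (ℕ→ℚ 2 * x - ℕ→ℚ 3)

  ℕ→ℚ-NUM : ∀ m → ℕ→ℚ (NUM m) ≡ numerator (ℕ→ℚ (5 ℕ.+ m))
  ℕ→ℚ-NUM m = begin
    ℕ→ℚ (45 ℕ.* m ℕ.* m ℕ.+ 315 ℕ.* m ℕ.+ 480) ≡⟨ ℕ→ℚ-quadratic 45 315 480 m ⟩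
    ℕ→ℚ 45 * y * y + ℕ→ℚ 315 * y + ℕ→ℚ 480     ≡⟨ shift y ⟩
    numerator (ℕ→ℚ 5 + y)                        ≡⟨ cong numerator (sym (ℕ→ℚ-+ 5 m)) ⟩
    numerator (ℕ→ℚ (5 ℕ.+ m))                    ∎
    where
    open ≡-Reasoning
    y = ℕ→ℚ m
    shift : ∀ y → ℕ→ℚ 45 * y * y + ℕ→ℚ 315 * y + ℕ→ℚ 480
                ≡ ℕ→ℚ 45 * (ℕ→ℚ 5 + y) * (ℕ→ℚ 5 + y) - ℕ→ℚ 135 * (ℕ→ℚ 5 + y) + ℕ→ℚ 30
    shift = solve-∀ ℚ-ring

  ℕ→ℚ-DEN : ∀ m → ℕ→ℚ (DEN m) ≡ denominator (ℕ→ℚ (5 ℕ.+ m))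
  ℕ→ℚ-DEN m = begin
    ℕ→ℚ (2 ℕ.* (5 ℕ.+ 2 ℕ.* m) ℕ.* (9 ℕ.+ 2 ℕ.* m) ℕ.* (7 ℕ.+ 2 ℕ.* m))
      ≡⟨ ℕ→ℚ-* (2 ℕ.* (5 ℕ.+ 2 ℕ.* m) ℕ.* (9 ℕ.+ 2 ℕ.* m)) (7 ℕ.+ 2 ℕ.* m) ⟩
    ℕ→ℚ (2 ℕ.* (5 ℕ.+ 2 ℕ.* m) ℕ.* (9 ℕ.+ 2 ℕ.* m)) * ℕ→ℚ (7 ℕ.+ 2 ℕ.* m)
      ≡⟨ cong (_* ℕ→ℚ (7 ℕ.+ 2 ℕ.* m)) (ℕ→ℚ-* (2 ℕ.* (5 ℕ.+ 2 ℕ.* m)) (9 ℕ.+ 2 ℕ.* m)) ⟩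
    ℕ→ℚ (2 ℕ.* (5 ℕ.+ 2 ℕ.* m)) * ℕ→ℚ (9 ℕ.+ 2 ℕ.* m) * ℕ→ℚ (7 ℕ.+ 2 ℕ.* m)
      ≡⟨ cong (λ a → a * ℕ→ℚ (9 ℕ.+ 2 ℕ.* m) * ℕ→ℚ (7 ℕ.+ 2 ℕ.* m)) (ℕ→ℚ-* 2 (5 ℕ.+ 2 ℕ.* m)) ⟩
    ℕ→ℚ 2 * ℕ→ℚ (5 ℕ.+ 2 ℕ.* m) * ℕ→ℚ (9 ℕ.+ 2 ℕ.* m) * ℕ→ℚ (7 ℕ.+ 2 ℕ.* m)
      ≡⟨ cong₂ (λ a b → ℕ→ℚ 2 * a * b * ℕ→ℚ (7 ℕ.+ 2 ℕ.* m)) (linear 5) (linear 9) ⟩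
    ℕ→ℚ 2 * (ℕ→ℚ 5 + ℕ→ℚ 2 * y) * (ℕ→ℚ 9 + ℕ→ℚ 2 * y) * ℕ→ℚ (7 ℕ.+ 2 ℕ.* m)
      ≡⟨ cong (ℕ→ℚ 2 * (ℕ→ℚ 5 + ℕ→ℚ 2 * y) * (ℕ→ℚ 9 + ℕ→ℚ 2 * y) *_) (linear 7) ⟩
    ℕ→ℚ 2 * (ℕ→ℚ 5 + ℕ→ℚ 2 * y) * (ℕ→ℚ 9 + ℕ→ℚ 2 * y) * (ℕ→ℚ 7 + ℕ→ℚ 2 * y)
      ≡⟨ shift y ⟩
    denominator (ℕ→ℚ 5 + y)
      ≡⟨ cong denominator (sym (ℕ→ℚ-+ 5 m)) ⟩
    denominator (ℕ→ℚ (5 ℕ.+ m)) ∎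
    where
    open ≡-Reasoning
    y = ℕ→ℚ m
    linear : ∀ k → ℕ→ℚ (k ℕ.+ 2 ℕ.* m) ≡ ℕ→ℚ k + ℕ→ℚ 2 * y
    linear k = trans (ℕ→ℚ-+ k (2 ℕ.* m)) (cong (ℕ→ℚ k +_) (ℕ→ℚ-* 2 m))
    shift : ∀ y → ℕ→ℚ 2 * (ℕ→ℚ 5 + ℕ→ℚ 2 * y) * (ℕ→ℚ 9 + ℕ→ℚ 2 * y) * (ℕ→ℚ 7 + ℕ→ℚ 2 * y)
                ≡ ℕ→ℚ 2 * (ℕ→ℚ 2 * (ℕ→ℚ 5 + y) - ℕ→ℚ 5) * (ℕ→ℚ 2 * (ℕ→ℚ 5 + y) - ℕ→ℚ 1) * (ℕ→ℚ 2 * (ℕ→ℚ 5 + y) - ℕ→ℚ 3)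
    shift = solve-∀ ℚ-ring

  -- Agda would unfold SP if asked to identify the two sides by refl, hence cong₂.
  SP-at-cells : ∀ m (h : 5 ℕ.≤ 5 ℕ.+ m) → SP (5 ℕ.+ m) (cell15 h) (cell22 h) ≡ SP (5 ℕ.+ m) (c₁₅ m) (c₂₂ m)
  SP-at-cells m h = cong₂ (SP (5 ℕ.+ m)) refl refl

  SP-formula : ∀ m (h : 5 ℕ.≤ 5 ℕ.+ m) →
               SP (5 ℕ.+ m) (cell15 h) (cell22 h) ≡ numerator (ℕ→ℚ (5 ℕ.+ m)) ÷? denominator (ℕ→ℚ (5 ℕ.+ m))
  SP-formula m h = trans (SP-at-cells m h) (trans (SP≡NUM/DEN m) (cong₂ _÷?_ (ℕ→ℚ-NUM m) (ℕ→ℚ-DEN m)))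

open ClosedForm

module MinimalSortingProbability where

  NUM-bound : ∀ m → NUM m ℕ.* (5 ℕ.+ m) ℕ.≤ 4 ℕ.* DEN m
  NUM-bound m = subst (NUM m ℕ.* (5 ℕ.+ m) ℕ.≤_) (sym (slack m)) (ℕP.m≤m+n _ _)
    where
    slack : ∀ m → 4 ℕ.* (2 ℕ.* (5 ℕ.+ 2 ℕ.* m) ℕ.* (9 ℕ.+ 2 ℕ.* m) ℕ.* (7 ℕ.+ 2 ℕ.* m))
                ≡ (45 ℕ.* m ℕ.* m ℕ.+ 315 ℕ.* m ℕ.+ 480) ℕ.* (5 ℕ.+ m) ℕ.+ (19 ℕ.* m ℕ.* m ℕ.* m ℕ.+ 132 ℕ.* m ℕ.* m ℕ.+ 233 ℕ.* m ℕ.+ 120)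
    slack = ℕSolver.solve-∀

  ∣SP∣≤4/n : ∀ m → ∣ SP (5 ℕ.+ m) (c₁₅ m) (c₂₂ m) ∣ ≤ ℕ→ℚ 4 * (ℕ→ℚ 1 ÷? ℕ→ℚ (5 ℕ.+ m))
  ∣SP∣≤4/n m = begin
    ∣ SP (5 ℕ.+ m) (c₁₅ m) (c₂₂ m) ∣       ≡⟨ cong ∣_∣ (SP≡NUM/DEN m) ⟩
    ∣ ℕ→ℚ (NUM m) ÷? ℕ→ℚ (DEN m) ∣         ≡⟨ ℚP.0≤p⇒∣p∣≡p (÷?-nonNeg (NUM m) (DEN m)) ⟩
    ℕ→ℚ (NUM m) ÷? ℕ→ℚ (DEN m)             ≤⟨ ÷?-mono-ℕ (NUM m) (DEN m) 4 (5 ℕ.+ m) (NUM-bound m) ⟩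
    ℕ→ℚ 4 ÷? ℕ→ℚ (5 ℕ.+ m)                 ≡⟨ sym (*-1÷? (ℕ→ℚ-≢0 (5 ℕ.+ m)) (ℕ→ℚ 4)) ⟩
    ℕ→ℚ 4 * (ℕ→ℚ 1 ÷? ℕ→ℚ (5 ℕ.+ m))       ∎
    where open ℚP.≤-Reasoning

  foldr-⊓-≤ : ∀ {x y} xs → y ∈ x ∷ xs → List.foldr _⊓_ x xs ≤ y
  foldr-⊓-≤ [] (here refl) = ℚP.≤-refl
  foldr-⊓-≤ (z ∷ zs) (here refl) = ℚP.≤-trans (ℚP.p⊓q≤q z _) (foldr-⊓-≤ zs (here refl))
  foldr-⊓-≤ (z ∷ zs) (there (here refl)) = ℚP.p⊓q≤p z _
  foldr-⊓-≤ (z ∷ zs) (there (there y∈zs)) = ℚP.≤-trans (ℚP.p⊓q≤q z _) (foldr-⊓-≤ zs (there y∈zs))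

  foldr-⊓-glb : ∀ {x z} xs → z ≤ x → All (z ≤_) xs → z ≤ List.foldr _⊓_ x xs
  foldr-⊓-glb [] z≤x [] = z≤x
  foldr-⊓-glb (y ∷ ys) z≤x (z≤y ∷ z≤ys) = ℚP.⊓-glb z≤y (foldr-⊓-glb ys z≤x z≤ys)

  minimumℚ-≤ : ∀ {xs y} → y ∈ xs → minimumℚ xs ≤ y
  minimumℚ-≤ {x ∷ xs} = foldr-⊓-≤ xs

  minimumℚ-nonNeg : ∀ {xs} → All (0ℚ ≤_) xs → 0ℚ ≤ minimumℚ xs
  minimumℚ-nonNeg [] = ℚP.≤-refl
  minimumℚ-nonNeg {x ∷ xs} (0≤x ∷ 0≤xs) = foldr-⊓-glb xs 0≤x 0≤xs

  ∈-allCells : ∀ n (c : Cell n) → c ∈ allCells n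
  ∈-allCells n (i , j) = subst (_ ∈_) (sym (concatMap-map _,_ (allFin 2) (allFin n)))
    (∈-cartesianProductWith⁺ _,_ (∈-allFin i) (∈-allFin j))

  ∈-distinctPairs : ∀ n {c c′ : Cell n} → c ≢ c′ → (c , c′) ∈ distinctPairs n
  ∈-distinctPairs n {c} {c′} c≢c′ = ∈-filter⁺ _
    (subst (_ ∈_) (sym (concatMap-map _,_ (allCells n) (allCells n)))
      (∈-cartesianProductWith⁺ _,_ (∈-allCells n c) (∈-allCells n c′)))
    c≢c′

  ∣minSP∣≤∣SP∣ : ∀ n {c c′ : Cell n} → c ≢ c′ → ∣ minSP n ∣ ≤ ∣ SP n c c′ ∣
  ∣minSP∣≤∣SP∣ n {c} {c′} c≢c′ = subst (_≤ ∣ SP n c c′ ∣) (sym (ℚP.0≤p⇒∣p∣≡p nonNeg))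
    (minimumℚ-≤ (∈-map⁺ (λ p → ∣ SP n (proj₁ p) (proj₂ p) ∣) (∈-distinctPairs n c≢c′)))
    where
    nonNeg : 0ℚ ≤ minSP n
    nonNeg = minimumℚ-nonNeg (AllP.map⁺ (All.universal (λ p → ℚP.0≤∣p∣ (SP n (proj₁ p) (proj₂ p))) (distinctPairs n)))

open MinimalSortingProbability

module Asymptotics where

  expansion remainder : ℚ → ℚ
  expansion x = (ℤ.+ 45 ℚ./ 16) * (ℕ→ℚ 1 ÷? x) + (ℤ.+ 135 ℚ./ 32) * (ℕ→ℚ 1 ÷? (x * x))
              + (ℤ.+ 75 ℚ./ 16) * (ℕ→ℚ 1 ÷? (x * x * x))
  remainder x = ℕ→ℚ 1080 * x * x - ℕ→ℚ 9750 * x + ℕ→ℚ 4500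

  formula-minus-expansion : ∀ {x} → x ≢ 0ℚ → denominator x ≢ 0ℚ →
    numerator x ÷? denominator x - expansion x ≡ remainder x ÷? (denominator x * (ℕ→ℚ 32 * x * x * x))
  formula-minus-expansion {x} x≢0 D≢0 = ÷?-unique (*-≢0 D≢0 x³-scaled≢0) (begin
    (a - (c₁ * i₁ + c₂ * i₂ + c₃ * i₃)) * (D * (ℕ→ℚ 32 * x * x * x))
      ≡⟨ expand a i₁ i₂ i₃ D x ⟩
    a * D * (ℕ→ℚ 32 * x * x * x) - D * (ℕ→ℚ 90 * (i₁ * x) * x * x + ℕ→ℚ 135 * (i₂ * (x * x)) * x + ℕ→ℚ 150 * (i₃ * (x * x * x)))
      ≡⟨ cong₂ (λ u v → u * (ℕ→ℚ 32 * x * x * x) - D * v) (÷?-*-cancel D≢0 (numerator x))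
           (cong₂ _+_ (cong₂ (λ u v → ℕ→ℚ 90 * u * x * x + ℕ→ℚ 135 * v * x) (÷?-*-cancel x≢0 (ℕ→ℚ 1)) (÷?-*-cancel x²≢0 (ℕ→ℚ 1)))
                      (cong (ℕ→ℚ 150 *_) (÷?-*-cancel x³≢0 (ℕ→ℚ 1)))) ⟩
    numerator x * (ℕ→ℚ 32 * x * x * x) - D * (ℕ→ℚ 90 * ℕ→ℚ 1 * x * x + ℕ→ℚ 135 * ℕ→ℚ 1 * x + ℕ→ℚ 150 * ℕ→ℚ 1)
      ≡⟨ collect x ⟩
    remainder x ∎)
    where
    open ≡-Reasoning
    D = denominator x
    a = numerator x ÷? D
    c₁ = ℤ.+ 45 ℚ./ 16
    c₂ = ℤ.+ 135 ℚ./ 32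
    c₃ = ℤ.+ 75 ℚ./ 16
    i₁ = ℕ→ℚ 1 ÷? x
    i₂ = ℕ→ℚ 1 ÷? (x * x)
    i₃ = ℕ→ℚ 1 ÷? (x * x * x)
    x²≢0 = *-≢0 x≢0 x≢0
    x³≢0 = *-≢0 x²≢0 x≢0
    x³-scaled≢0 = *-≢0 (*-≢0 (*-≢0 (ℕ→ℚ-≢0 32) x≢0) x≢0) x≢0
    expand : ∀ a i₁ i₂ i₃ D x →
      (a - ((ℤ.+ 45 ℚ./ 16) * i₁ + (ℤ.+ 135 ℚ./ 32) * i₂ + (ℤ.+ 75 ℚ./ 16) * i₃)) * (D * (ℕ→ℚ 32 * x * x * x))
      ≡ a * D * (ℕ→ℚ 32 * x * x * x) - D * (ℕ→ℚ 90 * (i₁ * x) * x * x + ℕ→ℚ 135 * (i₂ * (x * x)) * x + ℕ→ℚ 150 * (i₃ * (x * x * x)))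
    expand = solve-∀ ℚ-ring
    collect : ∀ x → (ℕ→ℚ 45 * x * x - ℕ→ℚ 135 * x + ℕ→ℚ 30) * (ℕ→ℚ 32 * x * x * x)
                    - ℕ→ℚ 2 * (ℕ→ℚ 2 * x - ℕ→ℚ 5) * (ℕ→ℚ 2 * x - ℕ→ℚ 1) * (ℕ→ℚ 2 * x - ℕ→ℚ 3)
                      * (ℕ→ℚ 90 * ℕ→ℚ 1 * x * x + ℕ→ℚ 135 * ℕ→ℚ 1 * x + ℕ→ℚ 150 * ℕ→ℚ 1)
                    ≡ ℕ→ℚ 1080 * x * x - ℕ→ℚ 9750 * x + ℕ→ℚ 4500
    collect = solve-∀ ℚ-ring

  -- For n = 10 + k the numerator 1080n² - 9750n + 4500 of the error is positive (it is negative
  -- for 5 ≤ n ≤ 8), so the error is a fraction of naturals.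
  module _ (k : ℕ) where
    private
      n = 10 ℕ.+ k
      x = ℕ→ℚ n
      R = 1080 ℕ.* k ℕ.* k ℕ.+ 11850 ℕ.* k ℕ.+ 15000
      Y = DEN (5 ℕ.+ k) ℕ.* (32 ℕ.* n ℕ.* n ℕ.* n)

      remainder-ℕ : remainder x ≡ ℕ→ℚ R
      remainder-ℕ = begin
        remainder x                                                 ≡⟨ cong remainder (ℕ→ℚ-+ 10 k) ⟩
        remainder (ℕ→ℚ 10 + ℕ→ℚ k)                                  ≡⟨ shift (ℕ→ℚ k) ⟩
        ℕ→ℚ 1080 * ℕ→ℚ k * ℕ→ℚ k + ℕ→ℚ 11850 * ℕ→ℚ k + ℕ→ℚ 15000  ≡⟨ sym (ℕ→ℚ-quadratic 1080 11850 15000 k) ⟩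
        ℕ→ℚ R                                                       ∎
        where
        open ≡-Reasoning
        shift : ∀ t → ℕ→ℚ 1080 * (ℕ→ℚ 10 + t) * (ℕ→ℚ 10 + t) - ℕ→ℚ 9750 * (ℕ→ℚ 10 + t) + ℕ→ℚ 4500
                      ≡ ℕ→ℚ 1080 * t * t + ℕ→ℚ 11850 * t + ℕ→ℚ 15000
        shift = solve-∀ ℚ-ring

      scale-ℕ : denominator x * (ℕ→ℚ 32 * x * x * x) ≡ ℕ→ℚ Y
      scale-ℕ = sym (trans (ℕ→ℚ-* (DEN (5 ℕ.+ k)) (32 ℕ.* n ℕ.* n ℕ.* n))
                           (cong₂ _*_ (ℕ→ℚ-DEN (5 ℕ.+ k)) (ℕ→ℚ-cubic 32 n)))

      remainder-bound : R ℕ.* (n ℕ.* n ℕ.* n ℕ.* n) ℕ.≤ 4 ℕ.* Y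
      remainder-bound = subst (R ℕ.* (n ℕ.* n ℕ.* n ℕ.* n) ℕ.≤_) (sym (slack k)) (ℕP.m≤m+n _ _)
        where
        slack : ∀ k → 4 ℕ.* (2 ℕ.* (5 ℕ.+ 2 ℕ.* (5 ℕ.+ k)) ℕ.* (9 ℕ.+ 2 ℕ.* (5 ℕ.+ k)) ℕ.* (7 ℕ.+ 2 ℕ.* (5 ℕ.+ k))
                          ℕ.* (32 ℕ.* (10 ℕ.+ k) ℕ.* (10 ℕ.+ k) ℕ.* (10 ℕ.+ k)))
                  ≡ (1080 ℕ.* k ℕ.* k ℕ.+ 11850 ℕ.* k ℕ.+ 15000) ℕ.* ((10 ℕ.+ k) ℕ.* (10 ℕ.+ k) ℕ.* (10 ℕ.+ k) ℕ.* (10 ℕ.+ k))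
                    ℕ.+ (968 ℕ.* k ℕ.* k ℕ.* k ℕ.+ 29574 ℕ.* k ℕ.* k ℕ.+ 308356 ℕ.* k ℕ.+ 1090320) ℕ.* ((10 ℕ.+ k) ℕ.* (10 ℕ.+ k) ℕ.* (10 ℕ.+ k))
        slack = ℕSolver.solve-∀

    ∣SP-expansion∣≤4/n⁴ : ∀ (h : 5 ℕ.≤ n) → ∣ SP n (cell15 h) (cell22 h) - expansion x ∣ ≤ ℕ→ℚ 4 * (ℕ→ℚ 1 ÷? (x * x * x * x))
    ∣SP-expansion∣≤4/n⁴ h = begin
      ∣ SP n (cell15 h) (cell22 h) - expansion x ∣                 ≡⟨ cong (λ s → ∣ s - expansion x ∣) (SP-formula (5 ℕ.+ k) h) ⟩
      ∣ numerator x ÷? denominator x - expansion x ∣               ≡⟨ cong ∣_∣ (formula-minus-expansion (ℕ→ℚ-≢0 n) D≢0) ⟩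
      ∣ remainder x ÷? (denominator x * (ℕ→ℚ 32 * x * x * x)) ∣    ≡⟨ cong₂ (λ a b → ∣ a ÷? b ∣) remainder-ℕ scale-ℕ ⟩
      ∣ ℕ→ℚ R ÷? ℕ→ℚ Y ∣                                           ≡⟨ ℚP.0≤p⇒∣p∣≡p (÷?-nonNeg R Y) ⟩
      ℕ→ℚ R ÷? ℕ→ℚ Y                                               ≤⟨ ÷?-mono-ℕ R Y 4 (n ℕ.* n ℕ.* n ℕ.* n) remainder-bound ⟩
      ℕ→ℚ 4 ÷? ℕ→ℚ (n ℕ.* n ℕ.* n ℕ.* n)                           ≡⟨ cong (ℕ→ℚ 4 ÷?_) (ℕ→ℚ-cubic n n) ⟩
      ℕ→ℚ 4 ÷? (x * x * x * x)                                     ≡⟨ sym (*-1÷? x⁴≢0 (ℕ→ℚ 4)) ⟩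
      ℕ→ℚ 4 * (ℕ→ℚ 1 ÷? (x * x * x * x))                           ∎
      where
      open ℚP.≤-Reasoning
      D≢0 = subst (_≢ 0ℚ) (ℕ→ℚ-DEN (5 ℕ.+ k)) (ℕ→ℚ-≢0 (DEN (5 ℕ.+ k)))
      x⁴≢0 = subst (_≢ 0ℚ) (ℕ→ℚ-cubic n n) (ℕ→ℚ-≢0 (n ℕ.* n ℕ.* n ℕ.* n))

open Asymptotics

mainTheorem2 :
    -- exact formula, for every n ≥ 5
    (∀ (n : ℕ) (h : 5 ℕ.≤ n) →
      SP n (cell15 h) (cell22 h)
        ≡ (ℕ→ℚ 45 * ℕ→ℚ n * ℕ→ℚ n - ℕ→ℚ 135 * ℕ→ℚ n + ℕ→ℚ 30)
          ÷? (ℕ→ℚ 2 * (ℕ→ℚ 2 * ℕ→ℚ n - ℕ→ℚ 5) * (ℕ→ℚ 2 * ℕ→ℚ n - ℕ→ℚ 1) * (ℕ→ℚ 2 * ℕ→ℚ n - ℕ→ℚ 3)))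
    -- asymptotic expansion: SP = 45/16 · 1/n + 135/32 · 1/n² + 75/16 · 1/n³ + O(1/n⁴)
    × (∃ λ (C : ℚ) → ∃ λ (N : ℕ) → ∀ (n : ℕ) (h : 5 ℕ.≤ n) → N ℕ.≤ n →
        ∣ SP n (cell15 h) (cell22 h)
          - ((ℤ.+ 45 ℚ./ 16) * (ℕ→ℚ 1 ÷? ℕ→ℚ n)
             + (ℤ.+ 135 ℚ./ 32) * (ℕ→ℚ 1 ÷? (ℕ→ℚ n * ℕ→ℚ n))
             + (ℤ.+ 75 ℚ./ 16) * (ℕ→ℚ 1 ÷? (ℕ→ℚ n * ℕ→ℚ n * ℕ→ℚ n))) ∣
          ≤ C * (ℕ→ℚ 1 ÷? (ℕ→ℚ n * ℕ→ℚ n * ℕ→ℚ n * ℕ→ℚ n)))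
    -- consequence: the minimal sorting probability of (n,n) is O(1/n)
    × (∃ λ (C : ℚ) → ∃ λ (N : ℕ) → ∀ (n : ℕ) → N ℕ.≤ n →
        ∣ minSP n ∣ ≤ C * (ℕ→ℚ 1 ÷? ℕ→ℚ n))
mainTheorem2 = exact , (ℕ→ℚ 4 , 10 , expansion-error) , (ℕ→ℚ 4 , 5 , minimal)
  where
  exact : ∀ n (h : 5 ℕ.≤ n) → SP n (cell15 h) (cell22 h) ≡ numerator (ℕ→ℚ n) ÷? denominator (ℕ→ℚ n)
  exact _ h@(s≤s (s≤s (s≤s (s≤s (s≤s _))))) = SP-formula _ h
  expansion-error : ∀ n (h : 5 ℕ.≤ n) → 10 ℕ.≤ n →
    ∣ SP n (cell15 h) (cell22 h) - expansion (ℕ→ℚ n) ∣ ≤ ℕ→ℚ 4 * (ℕ→ℚ 1 ÷? (ℕ→ℚ n * ℕ→ℚ n * ℕ→ℚ n * ℕ→ℚ n))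
  expansion-error _ h (s≤s (s≤s (s≤s (s≤s (s≤s (s≤s (s≤s (s≤s (s≤s (s≤s _)))))))))) = ∣SP-expansion∣≤4/n⁴ _ h
  minimal : ∀ n → 5 ℕ.≤ n → ∣ minSP n ∣ ≤ ℕ→ℚ 4 * (ℕ→ℚ 1 ÷? ℕ→ℚ n)
  minimal _ (s≤s (s≤s (s≤s (s≤s (s≤s {n = m} _))))) = ℚP.≤-trans (∣minSP∣≤∣SP∣ (5 ℕ.+ m) (λ ())) (∣SP∣≤4/n m)
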